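{- Let $r\geq3$. Then $$\sum_{n\geq1}\det(1;T_{0}^{(r)},T_{2}^{(r)},\ldots,T_{2n-2}^{(r)})x^n=\begin{cases}\dfrac{(-x)^{\frac{r+1}{2}}(-1-x)}{1+3x+x^2-(-x)^{\frac{r+1}{2}}-(-x)^{\frac{r+3}{2}}+x^r}, & r\text{ odd};\\[8pt] \dfrac{ -(-x)^{\frac{r}{2}+1}}{1+3x+x^2-2(-x)^{\frac{r}{2}}+3(-x)^{\frac{r}{2}+1}+x^r}, & r\text{ even},\end{cases}$$ $$\sum_{n\geq1}\det(-1;T_{0}^{(r)},T_{2}^{(r)},\ldots,T_{2n-2}^{(r)})x^n=\begin{cases}\dfrac{x^{\frac{r+1}{2}}(1-x)}{1-3x+x^2-3x^{\frac{r+1}{2}}+x^{\frac{r+3}{2}}-x^r}, & r\text{ odd};\\[8pt] \dfrac{x^{\frac{r}{2}+1}}{1-3x+x^2-2x^{\frac{r}{2}}+x^{\frac{r}{2}+1}+x^r}, & r\text{ even},\end{cases}$$ and $$\sum_{n\geq1}\det(1;T_{r+2}^{(r)},T_{r+3}^{(r)},\ldots,T_{n+r+1}^{(r)})x^n=\frac{3x-2x^2-(-x)^{r-2}-(-x)^{r-1}-2(-x)^r}{1-2x+x^2+(-x)^{r-2}+(-x)^{r-1}+(-x)^r},$$ as formal power series in $x$.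
   Context: For $r\ge3$, the generalized $r$-tribonacci numbers are defined by $T_0^{(r)}=\cdots=T_{r-2}^{(r)}=0$, $T_{r-1}^{(r)}=1$, and $T_n^{(r)}=T_{n-1}^{(r)}+T_{n-2}^{(r)}+T_{n-r}^{(r)}$ for $n\geq r$. For numbers $a_0,\ldots,a_n$, $\det(a_0;a_1,\ldots,a_n)$ denotes the determinant of the $n\times n$ Toeplitz--Hessenberg matrix whose $(i,j)$ entry is $a_{i-j+1}$ if $i-j+1\ge0$ and $0$ otherwise; in $T_0^{(r)},T_2^{(r)},\ldots,T_{2n-2}^{(r)}$ the $k$-th entry is $T_{2k-2}^{(r)}$. -}

module Defs where

open import Data.Nat as ℕ using (ℕ; zero; suc; _∸_; _<ᵇ_; _≡ᵇ_)
open import Data.Integer using (ℤ; +_; -_; _+_; _*_; _-_)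
open import Data.Fin using (Fin; toℕ; punchIn) renaming (zero to fzero; suc to fsuc)
open import Data.List using (List; []; _∷_)
open import Data.Bool using (if_then_else_)

at : List ℤ → ℕ → ℤ
at []       _       = + 0
at (x ∷ xs) zero    = x
at (x ∷ xs) (suc k) = at xs k

-- next r n prev : value of T_n^(r), given prev = [T_{n-1}, T_{n-2}, …, T_0]
next : ℕ → ℕ → List ℤ → ℤ
next r n prev =
  if n <ᵇ (r ∸ 1) then + 0
  else if n ≡ᵇ (r ∸ 1) then + 1
  else at prev 0 + at prev 1 + at prev (r ∸ 1)

history : ℕ → ℕ → List ℤ
history r zero    = next r zero [] ∷ []
history r (suc n) = next r (suc n) (history r n) ∷ history r n

T : ℕ → ℕ → ℤ
T r n = at (history r n) 0

sumFin : ∀ n → (Fin n → ℤ) → ℤ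
sumFin zero    f = + 0
sumFin (suc n) f = f fzero + sumFin n (λ i → f (fsuc i))

sign : ℕ → ℤ
sign zero    = + 1
sign (suc k) = - sign k

det : ∀ n → (Fin n → Fin n → ℤ) → ℤ
det zero    M = + 1
det (suc n) M =
  sumFin (suc n) (λ j → sign (toℕ j) * M fzero j * det n (λ i k → M (fsuc i) (punchIn j k)))

-- Toeplitz–Hessenberg matrix of a : ℕ → ℤ (a 0 = a₀, a k = a_k):
-- (i,j) entry a_{i-j+1} if i-j+1 ≥ 0, else 0 (0-based indices; same difference)
toeplitzHessenberg : (a : ℕ → ℤ) → ∀ n → Fin n → Fin n → ℤ
toeplitzHessenberg a n i j =
  if (suc (toℕ i)) <ᵇ (toℕ j) then + 0 else a (suc (toℕ i) ∸ toℕ j)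

-- det(a₀; a₁, …, aₙ)  with  a k = a_k
detTH : (ℕ → ℤ) → ℕ → ℤ
detTH a n = det n (toeplitzHessenberg a n)

withHead : ℤ → (ℕ → ℤ) → ℕ → ℤ
withHead a₀ f zero    = a₀
withHead a₀ f (suc k) = f (suc k)

Series : Set
Series = ℕ → ℤ

const : ℤ → Series
const c zero    = c
const c (suc n) = + 0

X : Series
X zero          = + 0
X (suc zero)    = + 1
X (suc (suc n)) = + 0

_⊕_ : Series → Series → Series
(f ⊕ g) n = f n + g n
infixl 6 _⊕_

_⊖_ : Series → Series → Series
(f ⊖ g) n = f n - g n
infixl 6 _⊖_

⊝_ : Series → Series
(⊝ f) n = - f n
infix 8 ⊝_

convSum : Series → Series → ℕ → ℕ → ℤ
convSum f g n zero    = f 0 * g n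
convSum f g n (suc i) = f (suc i) * g (n ∸ suc i) + convSum f g n i

_⊛_ : Series → Series → Series
(f ⊛ g) n = convSum f g n n
infixl 7 _⊛_

_^ˢ_ : Series → ℕ → Series
f ^ˢ zero  = const (+ 1)
f ^ˢ suc k = f ⊛ (f ^ˢ k)
infixr 9 _^ˢ_

_·_ : ℤ → Series → Series
(c · f) n = c * f n
infixl 7 _·_

-- "F = N / D" as formal power series (D has constant term 1, so is invertible):
-- expressed as D ⊛ F = N coefficientwise
_≐_/_ : Series → Series → Series → Set
F ≐ N / D = ∀ n → (D ⊛ F) n ≡ N n
  where open import Relation.Binary.PropositionalEquality using (_≡_)
infix 4 _≐_/_

genEven : ℕ → ℤ → Series
genEven r a₀ zero    = + 0
genEven r a₀ (suc m) = detTH (withHead a₀ (λ k → T r (2 ℕ.* k ∸ 2))) (suc m)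

genShift : ℕ → Series
genShift r zero    = + 0
genShift r (suc m) = detTH (withHead (+ 1) (λ k → T r (k ℕ.+ r ℕ.+ 1))) (suc m)

module Submission where

-- For a sequence a, Laplace expansion of D_n = det(a₀; a₁, …, aₙ) along the first row gives
-- Trudi's recurrence D_{n+1} = Σ_{i≤n} (-a₀)ⁱ a_{i+1} D_{n-i}, i.e. (1 - x·W)·D = 1 for the
-- weight series W = Σ (-a₀)ⁱ a_{i+1} xⁱ (`trudi`).  Hence Σ_{n≥1} D_n xⁿ = num/den as soon as
-- (den + num)·x·W = num (`generating-function`), and it suffices to find an equation Q·W = R
-- with den + num = Q and x·R = num (`generating-function-from`).
-- The r-tribonacci series T satisfies P·T = x^{r-1} with P = 1 - x - x² - x^r.  In the first
-- two identities W(x) is E(∓x), E = Σ T_{2i} xⁱ the even bisection of T; bisecting P·T = x^{r-1}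
-- gives Q·E = R with Q = (ev P)² - x·(od P)² (`bisection`).  In the third identity W(x) is
-- w(-x) for the tail w of T with T = x^{r-1}(1 + x + 2x² + x³w), and cancelling x^{r-1} in
-- P·T = x^{r-1} gives Q·w = R.  The substitution x ↦ -x is a ring endomorphism of ℤ[[x]]
-- (`alt`), so it carries Q·E = R over to W(x) = E(-x).

open import Data.Nat using (ℕ)

module FiniteSums where

  open import Data.Nat as ℕ using (ℕ; zero; suc; _∸_; _<_; s≤s)
  import Data.Nat.Properties as ℕP
  open import Data.Integer using (ℤ; +_; -_; _+_; _*_)
  import Data.Integer.Properties as ℤP
  open import Data.Integer.Tactic.RingSolver using (solve-∀)
  open import Function using (_∘_)
  open import Relation.Binary.PropositionalEquality

  Σ : (ℕ → ℤ) → ℕ → ℤ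
  Σ h zero    = + 0
  Σ h (suc m) = h m + Σ h m

  Σ-cong : ∀ {h h'} m → (∀ j → j < m → h j ≡ h' j) → Σ h m ≡ Σ h' m
  Σ-cong zero    e = refl
  Σ-cong (suc m) e = cong₂ _+_ (e m ℕP.≤-refl) (Σ-cong m (λ j j<m → e j (ℕP.m≤n⇒m≤1+n j<m)))

  Σ-vanishing : ∀ {h} m → (∀ j → j < m → h j ≡ + 0) → Σ h m ≡ + 0
  Σ-vanishing zero    e = refl
  Σ-vanishing (suc m) e
    rewrite e m ℕP.≤-refl | Σ-vanishing m (λ j j<m → e j (ℕP.m≤n⇒m≤1+n j<m)) = refl

  Σ-+ : ∀ h h' m → Σ (λ j → h j + h' j) m ≡ Σ h m + Σ h' m
  Σ-+ h h' zero    = refl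
  Σ-+ h h' (suc m) rewrite Σ-+ h h' m = interchange (h m) (h' m) (Σ h m) (Σ h' m)
    where
    interchange : ∀ a b c d → a + b + (c + d) ≡ a + c + (b + d)
    interchange = solve-∀

  Σ-*ˡ : ∀ c h m → c * Σ h m ≡ Σ (λ j → c * h j) m
  Σ-*ˡ c h zero    = ℤP.*-zeroʳ c
  Σ-*ˡ c h (suc m) rewrite sym (Σ-*ˡ c h m) = ℤP.*-distribˡ-+ c (h m) (Σ h m)

  Σ-*ʳ : ∀ c h m → Σ h m * c ≡ Σ (λ j → h j * c) m
  Σ-*ʳ c h m =
    trans (ℤP.*-comm (Σ h m) c) (trans (Σ-*ˡ c h m) (Σ-cong m (λ j _ → ℤP.*-comm c (h j))))

  Σ-neg : ∀ h m → - Σ h m ≡ Σ (λ j → - h j) m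
  Σ-neg h zero    = refl
  Σ-neg h (suc m) rewrite sym (Σ-neg h m) = ℤP.neg-distrib-+ (h m) (Σ h m)

  Σ-first : ∀ h m → Σ h (suc m) ≡ h 0 + Σ (h ∘ suc) m
  Σ-first h zero    = refl
  Σ-first h (suc m) rewrite Σ-first h m = swap-left (h (suc m)) (h 0) (Σ (h ∘ suc) m)
    where
    swap-left : ∀ a b c → a + (b + c) ≡ b + (a + c)
    swap-left = solve-∀

  Σ-reverse : ∀ h m → Σ h m ≡ Σ (λ j → h (m ∸ suc j)) m
  Σ-reverse h zero    = refl
  Σ-reverse h (suc m) =
    trans (cong (λ z → h m + z) (Σ-reverse h m)) (sym (Σ-first (λ j → h (suc m ∸ suc j)) m))

  Σ-swap : ∀ (F : ℕ → ℕ → ℤ) M →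
    Σ (λ i → Σ (λ j → F j i) (suc i)) M ≡ Σ (λ j → Σ (λ l → F j (j ℕ.+ l)) (M ∸ j)) M
  Σ-swap F zero    = refl
  Σ-swap F (suc M) = begin
      Σ (λ j → F j M) (suc M) + Σ (λ i → Σ (λ j → F j i) (suc i)) M
    ≡⟨ cong (λ z → Σ (λ j → F j M) (suc M) + z) (trans (Σ-swap F M) (sym last-row-empty)) ⟩
      Σ (λ j → F j M) (suc M) + Σ rows (suc M)
    ≡⟨ sym (Σ-+ (λ j → F j M) rows (suc M)) ⟩
      Σ (λ j → F j M + rows j) (suc M)
    ≡⟨ Σ-cong (suc M) extend-row ⟩
      Σ (λ j → Σ (λ l → F j (j ℕ.+ l)) (suc M ∸ j)) (suc M)
    ∎
    where
    open ≡-Reasoning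
    rows : ℕ → ℤ
    rows j = Σ (λ l → F j (j ℕ.+ l)) (M ∸ j)
    last-row-empty : Σ rows (suc M) ≡ Σ rows M
    last-row-empty rewrite ℕP.n∸n≡0 M = ℤP.+-identityˡ _
    extend-row : ∀ j → j < suc M → F j M + rows j ≡ Σ (λ l → F j (j ℕ.+ l)) (suc M ∸ j)
    extend-row j (s≤s j≤M) rewrite ℕP.+-∸-assoc 1 j≤M =
      cong (λ i → F j i + rows j) (sym (ℕP.m+[n∸m]≡n j≤M))

module PowerSeries where

  open import Defs
  open FiniteSums
  open import Data.Nat as ℕ using (ℕ; zero; suc; _∸_; _<_; s≤s)
  import Data.Nat.Properties as ℕP
  open import Data.Integer as ℤ using (ℤ; +_; -_; _+_; _*_)
  import Data.Integer.Properties as ℤP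
  open import Data.Product using (_,_)
  open import Data.Maybe using (Maybe; just; nothing)
  open import Relation.Nullary using (yes; no)
  open import Relation.Binary.PropositionalEquality
  open import Relation.Binary.Structures using (IsEquivalence)
  open import Relation.Binary.Bundles using (Setoid)
  import Relation.Binary.Reasoning.Setoid
  open import Algebra.Structures using (IsCommutativeSemiring)
  open import Algebra.Solver.Ring.AlmostCommutativeRing
  open import Data.Fin using () renaming (zero to fzero; suc to fsuc)
  open import Data.Vec using (_∷_; [])

  -- equality of all coefficients; a record, so that both sides can be inferred
  infix 4 _≋_
  record _≋_ (f g : Series) : Set where
    constructor coefficientwise
    field coeff : ∀ n → f n ≡ g n
  open _≋_ public

  ≋-isEquivalence : IsEquivalence _≋_
  ≋-isEquivalence = record
    { refl  = coefficientwise (λ _ → refl)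
    ; sym   = λ e → coefficientwise (λ n → sym (coeff e n))
    ; trans = λ e e' → coefficientwise (λ n → trans (coeff e n) (coeff e' n))
    }

  open IsEquivalence ≋-isEquivalence public
    using () renaming (refl to ≋-refl; sym to ≋-sym; trans to ≋-trans)

  seriesSetoid : Setoid _ _
  seriesSetoid = record { isEquivalence = ≋-isEquivalence }

  0s 1s : Series
  0s = const (+ 0)
  1s = const (+ 1)

  ⊕-cong : ∀ {f f' g g'} → f ≋ f' → g ≋ g' → f ⊕ g ≋ f' ⊕ g'
  ⊕-cong e e' = coefficientwise (λ n → cong₂ _+_ (coeff e n) (coeff e' n))

  ⊖-cong : ∀ {f f' g g'} → f ≋ f' → g ≋ g' → f ⊖ g ≋ f' ⊖ g'
  ⊖-cong e e' = coefficientwise (λ n → cong₂ ℤ._-_ (coeff e n) (coeff e' n))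

  const-cong : ∀ {a b} → a ≡ b → const a ≋ const b
  const-cong refl = ≋-refl

  ⊝-cong : ∀ {f g} → f ≋ g → ⊝ f ≋ ⊝ g
  ⊝-cong e = coefficientwise (λ n → cong -_ (coeff e n))

  ⊛-sum : ∀ f g n → (f ⊛ g) n ≡ Σ (λ j → f j * g (n ∸ j)) (suc n)
  ⊛-sum f g n = partial n
    where
    partial : ∀ i → convSum f g n i ≡ Σ (λ j → f j * g (n ∸ j)) (suc i)
    partial zero    = sym (ℤP.+-identityʳ _)
    partial (suc i) = cong (λ z → f (suc i) * g (n ∸ suc i) + z) (partial i)

  via-sums : ∀ f g f' g' n →
    Σ (λ j → f j * g (n ∸ j)) (suc n) ≡ Σ (λ j → f' j * g' (n ∸ j)) (suc n) →
    (f ⊛ g) n ≡ (f' ⊛ g') n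
  via-sums f g f' g' n e = trans (⊛-sum f g n) (trans e (sym (⊛-sum f' g' n)))

  ⊛-cong : ∀ {f f' g g'} → f ≋ f' → g ≋ g' → f ⊛ g ≋ f' ⊛ g'
  ⊛-cong {f} {f'} {g} {g'} e e' = coefficientwise λ n → via-sums f g f' g' n
    (Σ-cong (suc n) (λ j _ → cong₂ _*_ (coeff e j) (coeff e' (n ∸ j))))

  ⊛-comm : ∀ f g → f ⊛ g ≋ g ⊛ f
  ⊛-comm f g = coefficientwise λ n → via-sums f g g f n
    (trans (Σ-reverse (λ j → f j * g (n ∸ j)) (suc n))
           (Σ-cong (suc n) (λ j j<1+n → trans (ℤP.*-comm (f (n ∸ j)) (g (n ∸ (n ∸ j))))
              (cong (λ i → g i * f (n ∸ j)) (ℕP.m∸[m∸n]≡n (ℕP.≤-pred j<1+n))))))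

  ⊛-distribˡ : ∀ f g h → f ⊛ (g ⊕ h) ≋ f ⊛ g ⊕ f ⊛ h
  ⊛-distribˡ f g h = coefficientwise λ n → begin
      (f ⊛ (g ⊕ h)) n
    ≡⟨ ⊛-sum f (g ⊕ h) n ⟩
      Σ (λ j → f j * (g (n ∸ j) + h (n ∸ j))) (suc n)
    ≡⟨ Σ-cong (suc n) (λ j _ → ℤP.*-distribˡ-+ (f j) (g (n ∸ j)) (h (n ∸ j))) ⟩
      Σ (λ j → f j * g (n ∸ j) + f j * h (n ∸ j)) (suc n)
    ≡⟨ Σ-+ (λ j → f j * g (n ∸ j)) (λ j → f j * h (n ∸ j)) (suc n) ⟩
      Σ (λ j → f j * g (n ∸ j)) (suc n) + Σ (λ j → f j * h (n ∸ j)) (suc n)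
    ≡⟨ sym (cong₂ _+_ (⊛-sum f g n) (⊛-sum f h n)) ⟩
      (f ⊛ g ⊕ f ⊛ h) n
    ∎
    where open ≡-Reasoning

  ⊛-distribʳ : ∀ f g h → (g ⊕ h) ⊛ f ≋ g ⊛ f ⊕ h ⊛ f
  ⊛-distribʳ f g h =
    ≋-trans (⊛-comm (g ⊕ h) f) (≋-trans (⊛-distribˡ f g h) (⊕-cong (⊛-comm f g) (⊛-comm f h)))

  ⊛-negˡ : ∀ f g → (⊝ f) ⊛ g ≋ ⊝ (f ⊛ g)
  ⊛-negˡ f g = coefficientwise λ n → trans (⊛-sum (⊝ f) g n)
    (trans (Σ-cong (suc n) (λ j _ → sym (ℤP.neg-distribˡ-* (f j) (g (n ∸ j)))))
           (trans (sym (Σ-neg (λ j → f j * g (n ∸ j)) (suc n))) (cong -_ (sym (⊛-sum f g n)))))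

  -- the constant series c is the scalar c: only its j = 0 term contributes
  const-⊛ : ∀ c f → const c ⊛ f ≋ c · f
  const-⊛ c f = coefficientwise λ n → trans (⊛-sum (const c) f n)
    (trans (Σ-first (λ j → const c j * f (n ∸ j)) n)
           (trans (cong (λ z → c * f n + z) (Σ-vanishing n (λ j _ → refl))) (ℤP.+-identityʳ _)))

  ⊛-identityˡ : ∀ f → 1s ⊛ f ≋ f
  ⊛-identityˡ f = ≋-trans (const-⊛ (+ 1) f) (coefficientwise λ n → ℤP.*-identityˡ (f n))

  ⊛-identityʳ : ∀ f → f ⊛ 1s ≋ f
  ⊛-identityʳ f = ≋-trans (⊛-comm f 1s) (⊛-identityˡ f)

  0s-coeff : ∀ n → 0s n ≡ + 0
  0s-coeff zero    = refl
  0s-coeff (suc n) = refl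

  ⊛-zeroˡ : ∀ f → 0s ⊛ f ≋ 0s
  ⊛-zeroˡ f = ≋-trans (const-⊛ (+ 0) f) (coefficientwise λ n → sym (0s-coeff n))

  ⊛-zeroʳ : ∀ f → f ⊛ 0s ≋ 0s
  ⊛-zeroʳ f = ≋-trans (⊛-comm f 0s) (⊛-zeroˡ f)

  -- associativity: both sides are the sum of f_j g_{i-j} h_{n-i} over 0 ≤ j ≤ i ≤ n

  ⊛-assoc : ∀ f g h → (f ⊛ g) ⊛ h ≋ f ⊛ (g ⊛ h)
  ⊛-assoc f g h = coefficientwise λ n → begin
      ((f ⊛ g) ⊛ h) n
    ≡⟨ ⊛-sum (f ⊛ g) h n ⟩
      Σ (λ i → (f ⊛ g) i * h (n ∸ i)) (suc n)
    ≡⟨ Σ-cong (suc n) (λ i _ → trans (cong (_* h (n ∸ i)) (⊛-sum f g i))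
                                     (Σ-*ʳ (h (n ∸ i)) (λ j → f j * g (i ∸ j)) (suc i))) ⟩
      Σ (λ i → Σ (λ j → F n j i) (suc i)) (suc n)
    ≡⟨ Σ-swap (F n) (suc n) ⟩
      Σ (λ j → Σ (λ l → F n j (j ℕ.+ l)) (suc n ∸ j)) (suc n)
    ≡⟨ Σ-cong (suc n) (inner n) ⟩
      Σ (λ j → f j * (g ⊛ h) (n ∸ j)) (suc n)
    ≡⟨ sym (⊛-sum f (g ⊛ h) n) ⟩
      (f ⊛ (g ⊛ h)) n
    ∎
    where
    open ≡-Reasoning
    F : ℕ → ℕ → ℕ → ℤ
    F n j i = f j * g (i ∸ j) * h (n ∸ i)
    inner : ∀ n j → j < suc n → Σ (λ l → F n j (j ℕ.+ l)) (suc n ∸ j) ≡ f j * (g ⊛ h) (n ∸ j)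
    inner n j (s≤s j≤n) = begin
        Σ (λ l → F n j (j ℕ.+ l)) (suc n ∸ j)
      ≡⟨ cong (Σ (λ l → F n j (j ℕ.+ l))) (ℕP.+-∸-assoc 1 j≤n) ⟩
        Σ (λ l → F n j (j ℕ.+ l)) (suc (n ∸ j))
      ≡⟨ Σ-cong (suc (n ∸ j)) (λ l _ →
           trans (cong₂ (λ a b → f j * g a * h b) (ℕP.m+n∸m≡n j l) (sym (ℕP.∸-+-assoc n j l)))
                 (ℤP.*-assoc (f j) _ _)) ⟩
        Σ (λ l → f j * (g l * h (n ∸ j ∸ l))) (suc (n ∸ j))
      ≡⟨ sym (Σ-*ˡ (f j) (λ l → g l * h (n ∸ j ∸ l)) (suc (n ∸ j))) ⟩
        f j * Σ (λ l → g l * h (n ∸ j ∸ l)) (suc (n ∸ j))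
      ≡⟨ cong (f j *_) (sym (⊛-sum g h (n ∸ j))) ⟩
        f j * (g ⊛ h) (n ∸ j)
      ∎

  -- ℤ[[x]] is a commutative ring; the solver needs it as an almost-commutative ring
  isCommutativeSemiring : IsCommutativeSemiring _≋_ _⊕_ _⊛_ 0s 1s
  isCommutativeSemiring = record
    { isSemiring = record
      { isSemiringWithoutAnnihilatingZero = record
        { +-isCommutativeMonoid = record
          { isMonoid = record
            { isSemigroup = record
              { isMagma = record { isEquivalence = ≋-isEquivalence ; ∙-cong = ⊕-cong }
              ; assoc = λ f g h → coefficientwise λ n → ℤP.+-assoc (f n) (g n) (h n)
              }
            ; identity =
                (λ f → coefficientwise λ n → trans (cong (_+ f n) (0s-coeff n)) (ℤP.+-identityˡ (f n))) ,
                (λ f → coefficientwise λ n → trans (cong (λ z → f n + z) (0s-coeff n)) (ℤP.+-identityʳ (f n)))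
            }
          ; comm = λ f g → coefficientwise λ n → ℤP.+-comm (f n) (g n)
          }
        ; *-cong = ⊛-cong
        ; *-assoc = ⊛-assoc
        ; *-identity = ⊛-identityˡ , ⊛-identityʳ
        ; distrib = (λ f g h → ⊛-distribˡ f g h) , (λ f g h → ⊛-distribʳ f g h)
        }
      ; zero = ⊛-zeroˡ , ⊛-zeroʳ
      }
    ; *-comm = ⊛-comm
    }

  seriesRing : AlmostCommutativeRing _ _
  seriesRing = record
    { Carrier = Series ; _≈_ = _≋_ ; _+_ = _⊕_ ; _*_ = _⊛_ ; -_ = ⊝_ ; 0# = 0s ; 1# = 1s
    ; isAlmostCommutativeRing = record
      { isCommutativeSemiring = isCommutativeSemiring
      ; -‿cong = ⊝-cong
      ; -‿*-distribˡ = ⊛-negˡ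
      ; -‿+-comm = λ f g → coefficientwise λ n → sym (ℤP.neg-distrib-+ (f n) (g n))
      }
    }

  -- integers embed as constant series; this is the coefficient map of the ring solver
  constant-series : ℤ.+-*-rawRing -Raw-AlmostCommutative⟶ seriesRing
  constant-series = record
    { ⟦_⟧ = const
    ; +-homo = λ a b → coefficientwise λ { zero → refl ; (suc n) → refl }
    ; *-homo = λ a b → ≋-sym (≋-trans (const-⊛ a (const b))
                                      (coefficientwise λ { zero → refl ; (suc n) → ℤP.*-zeroʳ a }))
    ; -‿homo = λ a → coefficientwise λ { zero → refl ; (suc n) → refl }
    ; 0-homo = coefficientwise λ { zero → refl ; (suc n) → refl }
    ; 1-homo = coefficientwise λ { zero → refl ; (suc n) → refl }
    }

  -- equality of coefficients is decidable, which lets the solver simplify constants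
  constants-equal? : ∀ (a b : ℤ) → Maybe (const a ≋ const b)
  constants-equal? a b with a ℤP.≟ b
  ... | yes refl = just ≋-refl
  ... | no _     = nothing

  open import Algebra.Solver.Ring ℤ.+-*-rawRing seriesRing constant-series constants-equal? public
    using (solve; _:=_; _:+_; _:*_; _:-_; :-_; _:^_; con; var; op; [+]; [*]; Polynomial; ⟦_⟧)
  module ≋-Reasoning = Relation.Binary.Reasoning.Setoid seriesSetoid

  -- integer polynomial expressions in two indeterminates, and their values at series x, p
  Shape : Set
  Shape = ∀ {n} → Polynomial n → Polynomial n → Polynomial n

  _[_,_] : Shape → Series → Series → Series
  S [ x , p ] = ⟦ S (var fzero) (var (fsuc fzero)) ⟧ (x ∷ p ∷ [])

module Shifts where

  open import Defs
  open PowerSeries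
  open FiniteSums using (Σ; Σ-first; Σ-vanishing)
  open import Data.Nat as ℕ using (ℕ; zero; suc; _∸_; _<_; s≤s; z≤n)
  import Data.Nat.Properties as ℕP
  open import Data.Integer using (+_; _+_; _*_)
  import Data.Integer.Properties as ℤP
  open import Relation.Binary.PropositionalEquality using (_≡_; refl; sym; trans; cong; cong₂; module ≡-Reasoning)

  shift : ℕ → Series → Series
  shift zero    f n       = f n
  shift (suc j) f zero    = + 0
  shift (suc j) f (suc n) = shift j f n

  drop : ℕ → Series → Series
  drop j f n = f (j ℕ.+ n)

  shift-cong : ∀ j {f g} → f ≋ g → shift j f ≋ shift j g
  shift-cong zero    e = e
  shift-cong (suc j) e = coefficientwise λ
    { zero → refl
    ; (suc n) → coeff (shift-cong j e) n }

  shift-at : ∀ j f n → shift j f (j ℕ.+ n) ≡ f n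
  shift-at zero    f n = refl
  shift-at (suc j) f n = shift-at j f n

  shift-below : ∀ j f n → n < j → shift j f n ≡ + 0
  shift-below (suc j) f zero    _         = refl
  shift-below (suc j) f (suc n) (s≤s n<j) = shift-below j f n n<j

  shift-suc-vanishing : ∀ j f n → (∀ i → i < n → f i ≡ + 0) → shift (suc j) f n ≡ + 0
  shift-suc-vanishing j       f zero    _ = refl
  shift-suc-vanishing zero    f (suc n) v = v n ℕP.≤-refl
  shift-suc-vanishing (suc j) f (suc n) v =
    shift-suc-vanishing j f n (λ i i<n → v i (ℕP.m≤n⇒m≤1+n i<n))

  shift-diagonal : ∀ j f → shift j f j ≡ f 0
  shift-diagonal zero    f = refl
  shift-diagonal (suc j) f = shift-diagonal j f

  shift-1-above : ∀ j n → j < n → shift j 1s n ≡ + 0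
  shift-1-above zero    (suc n) _         = refl
  shift-1-above (suc j) (suc n) (s≤s j<n) = shift-1-above j n j<n

  -- multiplication by x: only the j = 1 term of the Cauchy product survives
  X-⊛ : ∀ f → X ⊛ f ≋ shift 1 f
  X-⊛ f = coefficientwise λ
    { zero    → refl
    ; (suc n) → begin
        (X ⊛ f) (suc n)
      ≡⟨ ⊛-sum X f (suc n) ⟩
        Σ (λ j → X j * f (suc n ∸ j)) (suc (suc n))
      ≡⟨ Σ-first (λ j → X j * f (suc n ∸ j)) (suc n) ⟩
        + 0 + Σ (λ j → X (suc j) * f (n ∸ j)) (suc n)
      ≡⟨ ℤP.+-identityˡ _ ⟩
        Σ (λ j → X (suc j) * f (n ∸ j)) (suc n)
      ≡⟨ Σ-first (λ j → X (suc j) * f (n ∸ j)) n ⟩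
        + 1 * f n + Σ (λ j → X (suc (suc j)) * f (n ∸ suc j)) n
      ≡⟨ cong₂ _+_ (ℤP.*-identityˡ (f n)) (Σ-vanishing n (λ _ _ → refl)) ⟩
        f n + + 0
      ≡⟨ ℤP.+-identityʳ (f n) ⟩
        f n
      ∎ }
    where open ≡-Reasoning

  X^-⊛ : ∀ j f → X ^ˢ j ⊛ f ≋ shift j f
  X^-⊛ zero    f = ⊛-identityˡ f
  X^-⊛ (suc j) f = begin
      (X ⊛ X ^ˢ j) ⊛ f   ≈⟨ ⊛-assoc X (X ^ˢ j) f ⟩
      X ⊛ (X ^ˢ j ⊛ f)   ≈⟨ X-⊛ (X ^ˢ j ⊛ f) ⟩
      shift 1 (X ^ˢ j ⊛ f) ≈⟨ shift-cong 1 (X^-⊛ j f) ⟩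
      shift 1 (shift j f) ≈⟨ coefficientwise (λ { zero → refl ; (suc n) → refl }) ⟩
      shift (suc j) f    ∎
    where open ≋-Reasoning

  X^-as-shift : ∀ j → X ^ˢ j ≋ shift j 1s
  X^-as-shift j = ≋-trans (≋-sym (⊛-identityʳ (X ^ˢ j))) (X^-⊛ j 1s)

  X^-cancel : ∀ j {f g} → X ^ˢ j ⊛ f ≋ X ^ˢ j ⊛ g → f ≋ g
  X^-cancel j {f} {g} e = coefficientwise λ n → begin
      f n                        ≡⟨ sym (shift-at j f n) ⟩
      shift j f (j ℕ.+ n)         ≡⟨ sym (coeff (X^-⊛ j f) (j ℕ.+ n)) ⟩
      (X ^ˢ j ⊛ f) (j ℕ.+ n)      ≡⟨ coeff e (j ℕ.+ n) ⟩
      (X ^ˢ j ⊛ g) (j ℕ.+ n)      ≡⟨ coeff (X^-⊛ j g) (j ℕ.+ n) ⟩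
      shift j g (j ℕ.+ n)         ≡⟨ shift-at j g n ⟩
      g n                        ∎
    where open ≡-Reasoning

  factor-X^ : ∀ j f → (∀ i → i < j → f i ≡ + 0) → f ≋ X ^ˢ j ⊛ drop j f
  factor-X^ j f v = ≋-trans (as-shift j f v) (≋-sym (X^-⊛ j (drop j f)))
    where
    as-shift : ∀ j f → (∀ i → i < j → f i ≡ + 0) → f ≋ shift j (drop j f)
    as-shift zero    f v = ≋-refl
    as-shift (suc j) f v = coefficientwise λ
      { zero    → v zero (s≤s z≤n)
      ; (suc n) → coeff (as-shift j (λ m → f (suc m)) (λ i i<j → v (suc i) (s≤s i<j))) n }

  head-tail : ∀ f → f ≋ const (f 0) ⊕ X ⊛ drop 1 f
  head-tail f = coefficientwise λ
    { zero    → sym (ℤP.+-identityʳ (f 0))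
    ; (suc n) → sym (trans (cong (λ z → + 0 + z) (coeff (X-⊛ (drop 1 f)) (suc n)))
                           (ℤP.+-identityˡ (f (suc n)))) }

  ·-as-⊛ : ∀ c f → c · f ≋ const c ⊛ f
  ·-as-⊛ c f = ≋-sym (const-⊛ c f)

  ^-exponent : ∀ f {m n} → m ≡ n → f ^ˢ m ≋ f ^ˢ n
  ^-exponent f refl = ≋-refl

  ^-cong : ∀ {f g} k → f ≋ g → f ^ˢ k ≋ g ^ˢ k
  ^-cong zero    e = ≋-refl
  ^-cong (suc k) e = ⊛-cong e (^-cong k e)

  -- the exponents k + 1 and k + 2 of the theorem, unfolded
  ^-+1 : ∀ f k → f ^ˢ (k ℕ.+ 1) ≋ f ⊛ f ^ˢ k
  ^-+1 f k = ^-exponent f (ℕP.+-comm k 1)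

  ^-+2 : ∀ f k → f ^ˢ (k ℕ.+ 2) ≋ f ⊛ (f ⊛ f ^ˢ k)
  ^-+2 f k = ^-exponent f (ℕP.+-comm k 2)

  -- doubling, by a recursion that makes even and odd indices compute
  double : ℕ → ℕ
  double zero    = zero
  double (suc n) = suc (suc (double n))

  2*≡double : ∀ k → 2 ℕ.* k ≡ double k
  2*≡double zero    = refl
  2*≡double (suc k) = cong suc (trans (ℕP.+-suc k (k ℕ.+ 0)) (cong suc (2*≡double k)))

  ^-double : ∀ f k → f ^ˢ double k ≋ f ^ˢ k ⊛ f ^ˢ k
  ^-double f zero    = ≋-sym (⊛-identityˡ 1s)
  ^-double f (suc k) = begin
      f ⊛ (f ⊛ f ^ˢ double k)     ≈⟨ ⊛-cong ≋-refl (⊛-cong ≋-refl (^-double f k)) ⟩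
      f ⊛ (f ⊛ (f ^ˢ k ⊛ f ^ˢ k))
        ≈⟨ solve 2 (λ f q → f :* (f :* (q :* q)) := (f :* q) :* (f :* q)) ≋-refl f (f ^ˢ k) ⟩
      (f ⊛ f ^ˢ k) ⊛ (f ⊛ f ^ˢ k) ∎
    where open ≋-Reasoning

  ^-double-neg : ∀ f k → (⊝ f) ^ˢ double k ≋ f ^ˢ double k
  ^-double-neg f zero    = ≋-refl
  ^-double-neg f (suc k) = begin
      ⊝ f ⊛ (⊝ f ⊛ (⊝ f) ^ˢ double k) ≈⟨ ⊛-cong ≋-refl (⊛-cong ≋-refl (^-double-neg f k)) ⟩
      ⊝ f ⊛ (⊝ f ⊛ f ^ˢ double k)
        ≈⟨ solve 2 (λ f q → :- f :* (:- f :* q) := f :* (f :* q)) ≋-refl f (f ^ˢ double k) ⟩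
      f ⊛ (f ⊛ f ^ˢ double k)         ∎
    where open ≋-Reasoning

module Alternation where

  open import Defs
  open FiniteSums using (Σ; Σ-cong; Σ-*ˡ)
  open PowerSeries
  open Shifts using (^-cong)
  open import Data.Nat as ℕ using (ℕ; zero; suc; _∸_; _<_; s≤s)
  import Data.Nat.Properties as ℕP
  open import Data.Integer using (+_; -_; _*_)
  import Data.Integer.Properties as ℤP
  open import Data.Integer.Tactic.RingSolver using (solve-∀)
  open import Data.Fin using () renaming (zero to fzero; suc to fsuc)
  open import Data.Vec using (Vec)
  open import Data.Vec.Relation.Binary.Pointwise.Inductive using (Pointwise; lookup; _∷_; [])
  open import Relation.Binary.PropositionalEquality using (_≡_; refl; sym; trans; cong; module ≡-Reasoning)

  alt : Series → Series
  alt f n = sign n * f n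

  sign-+ : ∀ a b → sign (a ℕ.+ b) ≡ sign a * sign b
  sign-+ zero    b = sym (ℤP.*-identityˡ (sign b))
  sign-+ (suc a) b = trans (cong -_ (sign-+ a b)) (ℤP.neg-distribˡ-* (sign a) (sign b))

  alt-cong : ∀ {f g} → f ≋ g → alt f ≋ alt g
  alt-cong e = coefficientwise λ n → cong (sign n *_) (coeff e n)

  alt-⊕ : ∀ f g → alt (f ⊕ g) ≋ alt f ⊕ alt g
  alt-⊕ f g = coefficientwise λ n → ℤP.*-distribˡ-+ (sign n) (f n) (g n)

  alt-⊝ : ∀ f → alt (⊝ f) ≋ ⊝ alt f
  alt-⊝ f = coefficientwise λ n → sym (ℤP.neg-distribʳ-* (sign n) (f n))

  alt-const : ∀ c → alt (const c) ≋ const c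
  alt-const c = coefficientwise λ
    { zero    → ℤP.*-identityˡ c
    ; (suc n) → ℤP.*-zeroʳ (sign (suc n)) }

  alt-X : alt X ≋ ⊝ X
  alt-X = coefficientwise λ
    { zero          → refl
    ; (suc zero)    → refl
    ; (suc (suc n)) → ℤP.*-zeroʳ (sign (suc (suc n))) }

  -- (-1)ⁿ = (-1)ʲ (-1)ⁿ⁻ʲ distributes over each term of the Cauchy product
  alt-⊛ : ∀ f g → alt (f ⊛ g) ≋ alt f ⊛ alt g
  alt-⊛ f g = coefficientwise λ n → begin
      sign n * (f ⊛ g) n
    ≡⟨ cong (sign n *_) (⊛-sum f g n) ⟩
      sign n * Σ (λ j → f j * g (n ∸ j)) (suc n)
    ≡⟨ Σ-*ˡ (sign n) (λ j → f j * g (n ∸ j)) (suc n) ⟩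
      Σ (λ j → sign n * (f j * g (n ∸ j))) (suc n)
    ≡⟨ Σ-cong (suc n) (split-sign n) ⟩
      Σ (λ j → alt f j * alt g (n ∸ j)) (suc n)
    ≡⟨ sym (⊛-sum (alt f) (alt g) n) ⟩
      (alt f ⊛ alt g) n
    ∎
    where
    open ≡-Reasoning
    regroup : ∀ s t a b → s * t * (a * b) ≡ s * a * (t * b)
    regroup = solve-∀
    split-sign : ∀ n j → j < suc n → sign n * (f j * g (n ∸ j)) ≡ alt f j * alt g (n ∸ j)
    split-sign n j (s≤s j≤n) = begin
        sign n * (f j * g (n ∸ j))
      ≡⟨ cong (λ i → sign i * (f j * g (n ∸ j))) (sym (ℕP.m+[n∸m]≡n j≤n)) ⟩
        sign (j ℕ.+ (n ∸ j)) * (f j * g (n ∸ j))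
      ≡⟨ cong (_* (f j * g (n ∸ j))) (sign-+ j (n ∸ j)) ⟩
        sign j * sign (n ∸ j) * (f j * g (n ∸ j))
      ≡⟨ regroup (sign j) (sign (n ∸ j)) (f j) (g (n ∸ j)) ⟩
        alt f j * alt g (n ∸ j)
      ∎

  alt-^ : ∀ f k → alt (f ^ˢ k) ≋ (alt f) ^ˢ k
  alt-^ f zero    = alt-const (+ 1)
  alt-^ f (suc k) = ≋-trans (alt-⊛ f (f ^ˢ k)) (⊛-cong ≋-refl (alt-^ f k))

  alt-X^ : ∀ k → alt (X ^ˢ k) ≋ (⊝ X) ^ˢ k
  alt-X^ k = ≋-trans (alt-^ X k) (^-cong k alt-X)

  _Alternates_ : ∀ {n} → Vec Series n → Vec Series n → Set
  ρ Alternates ρ' = Pointwise (λ x x' → alt x ≋ x') ρ ρ'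

  -- being a ring endomorphism, x ↦ -x commutes with every polynomial expression
  alt-⟦⟧ : ∀ {n} (p : Polynomial n) {ρ ρ' : Vec Series n} → ρ Alternates ρ' →
           alt (⟦ p ⟧ ρ) ≋ ⟦ p ⟧ ρ'
  alt-⟦⟧ (op [+] p q)      a = ≋-trans (alt-⊕ _ _) (⊕-cong (alt-⟦⟧ p a) (alt-⟦⟧ q a))
  alt-⟦⟧ (op [*] p q)      a = ≋-trans (alt-⊛ _ _) (⊛-cong (alt-⟦⟧ p a) (alt-⟦⟧ q a))
  alt-⟦⟧ (con c)           a = alt-const c
  alt-⟦⟧ (var x)           a = lookup a x
  alt-⟦⟧ (:- p)            a = ≋-trans (alt-⊝ _) (⊝-cong (alt-⟦⟧ p a))
  alt-⟦⟧ (p :^ k) {ρ} {ρ'} a = power k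
    where
    power : ∀ k → alt (⟦ p :^ k ⟧ ρ) ≋ ⟦ p :^ k ⟧ ρ'
    power zero    = alt-const (+ 1)
    power (suc k) = ≋-trans (alt-⊛ _ _) (⊛-cong (alt-⟦⟧ p a) (power k))

  alt-transport : ∀ {n} (Q R : Polynomial n) {E} {ρ ρ' : Vec Series n} → ρ Alternates ρ' →
    ⟦ Q ⟧ ρ ⊛ E ≋ ⟦ R ⟧ ρ → ⟦ Q ⟧ ρ' ⊛ alt E ≋ ⟦ R ⟧ ρ'
  alt-transport Q R {E} {ρ} {ρ'} a QE=R = begin
      ⟦ Q ⟧ ρ' ⊛ alt E       ≈⟨ ⊛-cong (≋-sym (alt-⟦⟧ Q a)) ≋-refl ⟩
      alt (⟦ Q ⟧ ρ) ⊛ alt E  ≈⟨ ≋-sym (alt-⊛ (⟦ Q ⟧ ρ) E) ⟩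
      alt (⟦ Q ⟧ ρ ⊛ E)      ≈⟨ alt-cong QE=R ⟩
      alt (⟦ R ⟧ ρ)          ≈⟨ alt-⟦⟧ R a ⟩
      ⟦ R ⟧ ρ'               ∎
    where open ≋-Reasoning

  alt-shape : ∀ (Q R : Shape) {x p x' p' E} → alt x ≋ x' → alt p ≋ p' →
    Q [ x , p ] ⊛ E ≋ R [ x , p ] → Q [ x' , p' ] ⊛ alt E ≋ R [ x' , p' ]
  alt-shape Q R ax ap =
    alt-transport (Q (var fzero) (var (fsuc fzero))) (R (var fzero) (var (fsuc fzero))) (ax ∷ ap ∷ [])

-- Bisection f(x) = ev f (x²) + x·od f (x²) into even and odd parts.
module Bisection where

  open import Defs
  open FiniteSums using (Σ; Σ-cong)
  open PowerSeries
  open Shifts using (X-⊛; double)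
  open import Data.Nat as ℕ using (ℕ; zero; suc; _∸_; _≤_; s≤s)
  import Data.Nat.Properties as ℕP
  open import Data.Integer using (ℤ; _+_; _*_)
  import Data.Integer.Properties as ℤP
  open import Data.Integer.Tactic.RingSolver using (solve-∀)
  open import Function using (_∘_)
  open import Relation.Binary.PropositionalEquality using (_≡_; refl; sym; trans; cong; cong₂; module ≡-Reasoning)

  ev od : Series → Series
  ev f m = f (double m)
  od f m = f (suc (double m))

  ev-cong : ∀ {f g} → f ≋ g → ev f ≋ ev g
  ev-cong e = coefficientwise λ m → coeff e (double m)

  od-cong : ∀ {f g} → f ≋ g → od f ≋ od g
  od-cong e = coefficientwise λ m → coeff e (suc (double m))

  Σ-parity : ∀ h m → Σ h (double m) ≡ Σ (h ∘ double) m + Σ (h ∘ suc ∘ double) m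
  Σ-parity h zero    = refl
  Σ-parity h (suc m) rewrite Σ-parity h m =
    regroup (h (suc (double m))) (h (double m)) (Σ (h ∘ double) m) (Σ (h ∘ suc ∘ double) m)
    where
    regroup : ∀ a b c d → a + (b + (c + d)) ≡ b + c + (a + d)
    regroup = solve-∀

  double-∸ : ∀ m j → j ≤ m → double m ∸ double j ≡ double (m ∸ j)
  double-∸ m       zero    _         = refl
  double-∸ (suc m) (suc j) (s≤s j≤m) = double-∸ m j j≤m

  suc-double-∸ : ∀ m j → j ≤ m → suc (double m) ∸ double j ≡ suc (double (m ∸ j))
  suc-double-∸ m       zero    _         = refl
  suc-double-∸ (suc m) (suc j) (s≤s j≤m) = suc-double-∸ m j j≤m

  ev-⊛ : ∀ f g → ev (f ⊛ g) ≋ ev f ⊛ ev g ⊕ X ⊛ (od f ⊛ od g)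
  ev-⊛ f g = coefficientwise λ m → begin
      (f ⊛ g) (double m)
    ≡⟨ ⊛-sum f g (double m) ⟩
      h m (double m) + Σ (h m) (double m)
    ≡⟨ cong (λ z → h m (double m) + z) (Σ-parity (h m) m) ⟩
      h m (double m) + (Σ (h m ∘ double) m + Σ (h m ∘ suc ∘ double) m)
    ≡⟨ sym (ℤP.+-assoc (h m (double m)) _ _) ⟩
      Σ (h m ∘ double) (suc m) + Σ (h m ∘ suc ∘ double) m
    ≡⟨ cong₂ _+_ (even-terms m) (odd-terms m) ⟩
      (ev f ⊛ ev g) m + (X ⊛ (od f ⊛ od g)) m
    ∎
    where
    open ≡-Reasoning
    h : ℕ → ℕ → ℤ
    h m j = f j * g (double m ∸ j)
    even-terms : ∀ m → Σ (h m ∘ double) (suc m) ≡ (ev f ⊛ ev g) m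
    even-terms m = trans (Σ-cong (suc m) (λ j j<1+m →
        cong (λ i → f (double j) * g i) (double-∸ m j (ℕP.≤-pred j<1+m))))
      (sym (⊛-sum (ev f) (ev g) m))
    odd-terms : ∀ m → Σ (h m ∘ suc ∘ double) m ≡ (X ⊛ (od f ⊛ od g)) m
    odd-terms zero    = refl
    odd-terms (suc m) = trans (Σ-cong (suc m) (λ j j<1+m →
        cong (λ i → f (suc (double j)) * g i) (suc-double-∸ m j (ℕP.≤-pred j<1+m))))
      (trans (sym (⊛-sum (od f) (od g) m)) (sym (coeff (X-⊛ (od f ⊛ od g)) (suc m))))

  od-⊛ : ∀ f g → od (f ⊛ g) ≋ ev f ⊛ od g ⊕ od f ⊛ ev g
  od-⊛ f g = coefficientwise λ m → begin
      (f ⊛ g) (suc (double m))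
    ≡⟨ ⊛-sum f g (suc (double m)) ⟩
      Σ (h m) (double (suc m))
    ≡⟨ Σ-parity (h m) (suc m) ⟩
      Σ (h m ∘ double) (suc m) + Σ (h m ∘ suc ∘ double) (suc m)
    ≡⟨ cong₂ _+_ (even-terms m) (odd-terms m) ⟩
      (ev f ⊛ od g) m + (od f ⊛ ev g) m
    ∎
    where
    open ≡-Reasoning
    h : ℕ → ℕ → ℤ
    h m j = f j * g (suc (double m) ∸ j)
    even-terms : ∀ m → Σ (h m ∘ double) (suc m) ≡ (ev f ⊛ od g) m
    even-terms m = trans (Σ-cong (suc m) (λ j j<1+m →
        cong (λ i → f (double j) * g i) (suc-double-∸ m j (ℕP.≤-pred j<1+m))))
      (sym (⊛-sum (ev f) (od g) m))
    odd-terms : ∀ m → Σ (h m ∘ suc ∘ double) (suc m) ≡ (od f ⊛ ev g) m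
    odd-terms m = trans (Σ-cong (suc m) (λ j j<1+m →
        cong (λ i → f (suc (double j)) * g i) (double-∸ m j (ℕP.≤-pred j<1+m))))
      (sym (⊛-sum (od f) (ev g) m))

  ev-X-⊛ : ∀ g → ev (X ⊛ g) ≋ X ⊛ od g
  ev-X-⊛ g = ≋-trans (ev-cong (X-⊛ g)) (≋-trans (coefficientwise λ { zero → refl ; (suc m) → refl })
                                                  (≋-sym (X-⊛ (od g))))

  od-X-⊛ : ∀ g → od (X ⊛ g) ≋ ev g
  od-X-⊛ g = ≋-trans (od-cong (X-⊛ g)) (coefficientwise λ m → refl)

  ev-1 : ev 1s ≋ 1s
  ev-1 = coefficientwise λ { zero → refl ; (suc m) → refl }

  od-1 : od 1s ≋ 0s
  od-1 = coefficientwise λ { zero → refl ; (suc m) → refl }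

  ev-X : ev X ≋ 0s
  ev-X = coefficientwise λ { zero → refl ; (suc m) → refl }

  od-X : od X ≋ 1s
  od-X = coefficientwise λ { zero → refl ; (suc m) → refl }

  ev-even-power : ∀ j → ev (X ^ˢ double j) ≋ X ^ˢ j
  od-even-power : ∀ j → od (X ^ˢ double j) ≋ 0s
  ev-even-power zero    = ev-1
  ev-even-power (suc j) = begin
      ev (X ⊛ (X ⊛ X ^ˢ double j)) ≈⟨ ev-X-⊛ (X ⊛ X ^ˢ double j) ⟩
      X ⊛ od (X ⊛ X ^ˢ double j)   ≈⟨ ⊛-cong ≋-refl (od-X-⊛ (X ^ˢ double j)) ⟩
      X ⊛ ev (X ^ˢ double j)       ≈⟨ ⊛-cong ≋-refl (ev-even-power j) ⟩
      X ⊛ X ^ˢ j                   ∎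
    where open ≋-Reasoning
  od-even-power zero    = od-1
  od-even-power (suc j) = begin
      od (X ⊛ (X ⊛ X ^ˢ double j)) ≈⟨ od-X-⊛ (X ⊛ X ^ˢ double j) ⟩
      ev (X ⊛ X ^ˢ double j)       ≈⟨ ev-X-⊛ (X ^ˢ double j) ⟩
      X ⊛ od (X ^ˢ double j)       ≈⟨ ⊛-cong ≋-refl (od-even-power j) ⟩
      X ⊛ 0s                       ≈⟨ ⊛-zeroʳ X ⟩
      0s                           ∎
    where open ≋-Reasoning

  ev-odd-power : ∀ j → ev (X ^ˢ suc (double j)) ≋ 0s
  ev-odd-power j = ≋-trans (ev-X-⊛ (X ^ˢ double j))
    (≋-trans (⊛-cong ≋-refl (od-even-power j)) (⊛-zeroʳ X))

  od-odd-power : ∀ j → od (X ^ˢ suc (double j)) ≋ X ^ˢ j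
  od-odd-power j = ≋-trans (od-X-⊛ (X ^ˢ double j)) (ev-even-power j)

  -- the norm identity: (ev f² - x·od f²)·ev g = ev f·ev(fg) - x·od f·od(fg),
  -- stated for given closed forms e, o, c, d of the four bisection parts
  bisection : ∀ {f g e o c d} → ev f ≋ e → od f ≋ o → ev (f ⊛ g) ≋ c → od (f ⊛ g) ≋ d →
    (e ⊛ e ⊖ X ⊛ (o ⊛ o)) ⊛ ev g ≋ e ⊛ c ⊖ X ⊛ (o ⊛ d)
  bisection {f} {g} {e} {o} {c} {d} ev-f od-f ev-fg od-fg = begin
      (e ⊛ e ⊖ X ⊛ (o ⊛ o)) ⊛ ev g
    ≈⟨ solve 5 (λ x e o E O → (e :* e :- x :* (o :* o)) :* E
                  := e :* (e :* E :+ x :* (o :* O)) :- x :* (o :* (e :* O :+ o :* E)))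
             ≋-refl X e o (ev g) (od g) ⟩
      e ⊛ (e ⊛ ev g ⊕ X ⊛ (o ⊛ od g)) ⊖ X ⊛ (o ⊛ (e ⊛ od g ⊕ o ⊛ ev g))
    ≈⟨ ⊖-cong (⊛-cong ≋-refl even-part) (⊛-cong ≋-refl (⊛-cong ≋-refl odd-part)) ⟩
      e ⊛ c ⊖ X ⊛ (o ⊛ d)
    ∎
    where
    open ≋-Reasoning
    even-part : e ⊛ ev g ⊕ X ⊛ (o ⊛ od g) ≋ c
    even-part = ≋-trans (⊕-cong (⊛-cong (≋-sym ev-f) ≋-refl)
                                (⊛-cong ≋-refl (⊛-cong (≋-sym od-f) ≋-refl)))
                        (≋-trans (≋-sym (ev-⊛ f g)) ev-fg)
    odd-part : e ⊛ od g ⊕ o ⊛ ev g ≋ d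
    odd-part = ≋-trans (⊕-cong (⊛-cong (≋-sym ev-f) ≋-refl) (⊛-cong (≋-sym od-f) ≋-refl))
                       (≋-trans (≋-sym (od-⊛ f g)) od-fg)

-- The r-tribonacci series for r = m + 1 satisfies (1 - x - x² - x^r)·T(x) = x^m.
module Tribonacci (m : ℕ) where

  open import Defs
  open PowerSeries
  open Shifts using (shift; shift-suc-vanishing; shift-below; shift-diagonal; shift-1-above; X-⊛; X^-⊛; X^-as-shift)
  open import Data.Nat as ℕ using (ℕ; zero; suc; _<_; _<ᵇ_; _≡ᵇ_; s≤s; <-cmp)
  import Data.Nat.Properties as ℕP
  open import Data.Integer as ℤ using (+_; _+_; _-_)
  open import Data.Integer.Tactic.RingSolver using (solve-∀)
  open import Data.Bool using (true; false)
  open import Data.List using ([])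
  open import Relation.Binary.Definitions using (tri<; tri≈; tri>)
  open import Relation.Binary.PropositionalEquality using (_≡_; refl)

  t : Series
  t = T (suc m)

  P : Series
  P = 1s ⊖ X ⊖ X ^ˢ 2 ⊖ X ^ˢ suc m

  private
    <ᵇ-true : ∀ {a b} → a < b → (a <ᵇ b) ≡ true
    <ᵇ-true {zero}  {suc b} _         = refl
    <ᵇ-true {suc a} {suc b} (s≤s a<b) = <ᵇ-true a<b

    <ᵇ-false : ∀ {a b} → b ℕ.≤ a → (a <ᵇ b) ≡ false
    <ᵇ-false {a}     {zero}  _         = refl
    <ᵇ-false {suc a} {suc b} (s≤s b≤a) = <ᵇ-false b≤a

    ≡ᵇ-true : ∀ a → (a ≡ᵇ a) ≡ true
    ≡ᵇ-true zero    = refl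
    ≡ᵇ-true (suc a) = ≡ᵇ-true a

    ≡ᵇ-false : ∀ {a b} → b < a → (a ≡ᵇ b) ≡ false
    ≡ᵇ-false {suc a} {zero}  _         = refl
    ≡ᵇ-false {suc a} {suc b} (s≤s b<a) = ≡ᵇ-false b<a

  next-below : ∀ n prev → n < m → next (suc m) n prev ≡ + 0
  next-below n prev n<m rewrite <ᵇ-true n<m = refl

  next-leading : ∀ prev → next (suc m) m prev ≡ + 1
  next-leading prev rewrite <ᵇ-false (ℕP.≤-refl {m}) | ≡ᵇ-true m = refl

  next-above : ∀ n prev → m < n → next (suc m) n prev ≡ at prev 0 + at prev 1 + at prev m
  next-above n prev m<n rewrite <ᵇ-false (ℕP.<⇒≤ m<n) | ≡ᵇ-false m<n = refl

  t-next : ∀ n {v} → (∀ prev → next (suc m) n prev ≡ v) → t n ≡ v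
  t-next zero    e = e []
  t-next (suc n) e = e (history (suc m) n)

  history-shift : ∀ n j → at (history (suc m) n) j ≡ shift j t n
  history-shift n       zero    = refl
  history-shift zero    (suc j) = refl
  history-shift (suc n) (suc j) = history-shift n j

  t-below : ∀ n → n < m → t n ≡ + 0
  t-below n n<m = t-next n (λ prev → next-below n prev n<m)

  t-leading : t m ≡ + 1
  t-leading = t-next m next-leading

  t-recurrence : ∀ n → m < suc n → t (suc n) ≡ t n + shift 1 t n + shift m t n
  t-recurrence n m<1+n
    rewrite next-above (suc n) (history (suc m) n) m<1+n
          | history-shift n 1 | history-shift n m = refl

  shifted-vanishing : ∀ j n → n ℕ.≤ m → shift (suc j) t n ≡ + 0
  shifted-vanishing j n n≤m = shift-suc-vanishing j t n (λ i i<n → t-below i (ℕP.<-≤-trans i<n n≤m))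

  -- coefficientwise, P·t = xᵐ reads T_n - T_{n-1} - T_{n-2} - T_{n-r} = [n = m]
  private
    cancel : ∀ a b c → a + b + c - a - b - c ≡ + 0
    cancel = solve-∀

    coefficients : ∀ n → (t ⊖ shift 1 t ⊖ shift 2 t ⊖ shift (suc m) t) n ≡ shift m 1s n
    coefficients n with <-cmp n m
    ... | tri< n<m _ _
      rewrite t-below n n<m | shifted-vanishing 0 n (ℕP.<⇒≤ n<m) | shifted-vanishing 1 n (ℕP.<⇒≤ n<m)
            | shifted-vanishing m n (ℕP.<⇒≤ n<m) | shift-below m 1s n n<m = refl
    ... | tri≈ _ refl _
      rewrite t-leading | shifted-vanishing 0 m ℕP.≤-refl | shifted-vanishing 1 m ℕP.≤-refl
            | shifted-vanishing m m ℕP.≤-refl | shift-diagonal m 1s = refl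
    ... | tri> _ _ m<n = above n m<n
      where
      above : ∀ n → m < n → (t ⊖ shift 1 t ⊖ shift 2 t ⊖ shift (suc m) t) n ≡ shift m 1s n
      above (suc n) m<1+n rewrite t-recurrence n m<1+n | shift-1-above m (suc n) m<1+n =
        cancel (t n) (shift 1 t n) (shift m t n)

  tribonacci-equation : P ⊛ t ≋ X ^ˢ m
  tribonacci-equation = begin
      P ⊛ t
    ≈⟨ solve 3 (λ x xʳ u → (con (+ 1) :- x :- x :^ 2 :- xʳ) :* u := u :- x :* u :- x :^ 2 :* u :- xʳ :* u)
             ≋-refl X (X ^ˢ suc m) t ⟩
      t ⊖ X ⊛ t ⊖ X ^ˢ 2 ⊛ t ⊖ X ^ˢ suc m ⊛ t
    ≈⟨ ⊖-cong (⊖-cong (⊖-cong (≋-refl {t}) (X-⊛ t)) (X^-⊛ 2 t)) (X^-⊛ (suc m) t) ⟩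
      t ⊖ shift 1 t ⊖ shift 2 t ⊖ shift (suc m) t
    ≈⟨ coefficientwise coefficients ⟩
      shift m 1s
    ≈⟨ ≋-sym (X^-as-shift m) ⟩
      X ^ˢ m
    ∎
    where open ≋-Reasoning

module ToeplitzHessenberg where

  open import Defs
  open FiniteSums using (Σ; Σ-first; Σ-*ˡ; Σ-cong)
  open PowerSeries
  open Shifts using (X-⊛)
  open Alternation using (alt)
  open import Data.Nat as ℕ using (ℕ; zero; suc; _∸_)
  open import Data.Integer as ℤ using (ℤ; +_; -_; _+_; _*_; _-_; _^_)
  import Data.Integer.Properties as ℤP
  open import Data.Integer.Tactic.RingSolver using (solve-∀)
  open import Data.Fin using (Fin; toℕ; punchIn) renaming (zero to fzero; suc to fsuc)
  open import Function using (_∘_)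
  open import Relation.Binary.PropositionalEquality using (_≡_; refl; sym; trans; cong; cong₂; module ≡-Reasoning)

  -- D(x) = Σ_{n≥0} det(a₀; a₁, …, aₙ) xⁿ, with D_0 = 1
  determinants : (ℕ → ℤ) → Series
  determinants a n = detTH a n

  weights : (ℕ → ℤ) → Series
  weights a i = (- a 0) ^ i * a (suc i)

  sumFin-cong : ∀ n {f g : Fin n → ℤ} → (∀ i → f i ≡ g i) → sumFin n f ≡ sumFin n g
  sumFin-cong zero    e = refl
  sumFin-cong (suc n) e = cong₂ _+_ (e fzero) (sumFin-cong n (λ i → e (fsuc i)))

  sumFin-vanishing : ∀ n {f : Fin n → ℤ} → (∀ i → f i ≡ + 0) → sumFin n f ≡ + 0
  sumFin-vanishing zero    e = refl
  sumFin-vanishing (suc n) e rewrite e fzero | sumFin-vanishing n (λ i → e (fsuc i)) = refl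

  det-cong : ∀ n {M N : Fin n → Fin n → ℤ} → (∀ i j → M i j ≡ N i j) → det n M ≡ det n N
  det-cong zero    e = refl
  det-cong (suc n) e = sumFin-cong (suc n) (λ j →
    cong₂ (λ x y → sign (toℕ j) * x * y) (e fzero j) (det-cong n (λ i k → e (fsuc i) (punchIn j k))))

  module Expansion (a : ℕ → ℤ) where

    replaceColumn : (ℕ → ℤ) → ∀ n → Fin n → Fin n → ℤ
    replaceColumn b n i fzero    = b (suc (toℕ i))
    replaceColumn b n i (fsuc j) = toeplitzHessenberg a n i (fsuc j)

    Δ : (ℕ → ℤ) → ℕ → ℤ
    Δ b n = det n (replaceColumn b n)

    Δ-own-column : ∀ n → detTH a n ≡ Δ a n
    Δ-own-column n = det-cong n {toeplitzHessenberg a n} {replaceColumn a n}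
      (λ i → λ { fzero → refl ; (fsuc j) → refl })

    -- the first row is (b₁, a₀, 0, …, 0); the minor of b₁ is D_{n+1}, that of a₀ is Δ (b ∘ suc)
    Δ-expansion : ∀ b n → Δ b (suc (suc n)) ≡ b 1 * detTH a (suc n) - a 0 * Δ (b ∘ suc) (suc n)
    Δ-expansion b n = begin
        Δ b (suc (suc n))
      ≡⟨ cong₂ (λ u v → + 1 * b 1 * detTH a (suc n) + (- + 1 * a 0 * u + v)) second-minor later-terms ⟩
        + 1 * b 1 * detTH a (suc n) + (- + 1 * a 0 * Δ (b ∘ suc) (suc n) + + 0)
      ≡⟨ normalise (b 1) (detTH a (suc n)) (a 0) (Δ (b ∘ suc) (suc n)) ⟩
        b 1 * detTH a (suc n) - a 0 * Δ (b ∘ suc) (suc n)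
      ∎
      where
      open ≡-Reasoning
      M : Fin (suc (suc n)) → Fin (suc (suc n)) → ℤ
      M = replaceColumn b (suc (suc n))
      second-minor : det (suc n) (λ i k → M (fsuc i) (punchIn (fsuc fzero) k)) ≡ Δ (b ∘ suc) (suc n)
      second-minor = det-cong (suc n) {λ i k → M (fsuc i) (punchIn (fsuc fzero) k)}
                                      {replaceColumn (b ∘ suc) (suc n)}
        (λ i → λ { fzero → refl ; (fsuc k) → refl })
      later-terms : sumFin n (λ j → sign (toℕ (fsuc (fsuc j))) * + 0
                                      * det (suc n) (λ i k → M (fsuc i) (punchIn (fsuc (fsuc j)) k)))
                    ≡ + 0
      later-terms = sumFin-vanishing n (λ j →
        cong (λ z → z * det (suc n) (λ i k → M (fsuc i) (punchIn (fsuc (fsuc j)) k)))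
             (ℤP.*-zeroʳ (sign (suc (suc (toℕ j))))))
      normalise : ∀ x y z w → + 1 * x * y + (- + 1 * z * w + + 0) ≡ x * y - z * w
      normalise = solve-∀

    Δ-closed : ∀ b n → Δ b (suc n) ≡ Σ (λ i → (- a 0) ^ i * b (suc i) * detTH a (n ∸ i)) (suc n)
    Δ-closed b zero    = refl
    Δ-closed b (suc n) = begin
        Δ b (suc (suc n))
      ≡⟨ Δ-expansion b n ⟩
        b 1 * detTH a (suc n) - a 0 * Δ (b ∘ suc) (suc n)
      ≡⟨ cong (λ z → b 1 * detTH a (suc n) - a 0 * z) (Δ-closed (b ∘ suc) n) ⟩
        b 1 * detTH a (suc n) - a 0 * Σ (λ i → (- a 0) ^ i * b (suc (suc i)) * detTH a (n ∸ i)) (suc n)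
      ≡⟨ cong (λ z → b 1 * detTH a (suc n) + z)
              (trans (ℤP.neg-distribˡ-* (a 0) _) (Σ-*ˡ (- a 0) _ (suc n))) ⟩
        b 1 * detTH a (suc n) + Σ (λ i → - a 0 * ((- a 0) ^ i * b (suc (suc i)) * detTH a (n ∸ i))) (suc n)
      ≡⟨ cong₂ _+_ (cong (_* detTH a (suc n)) (sym (ℤP.*-identityˡ (b 1))))
                   (Σ-cong (suc n) (λ i _ → reassociate (- a 0) ((- a 0) ^ i) (b (suc (suc i))) (detTH a (n ∸ i)))) ⟩
        (- a 0) ^ 0 * b 1 * detTH a (suc n) + Σ (λ i → (- a 0) ^ suc i * b (suc (suc i)) * detTH a (n ∸ i)) (suc n)
      ≡⟨ sym (Σ-first (λ i → (- a 0) ^ i * b (suc i) * detTH a (suc n ∸ i)) (suc n)) ⟩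
        Σ (λ i → (- a 0) ^ i * b (suc i) * detTH a (suc n ∸ i)) (suc (suc n))
      ∎
      where
      open ≡-Reasoning
      reassociate : ∀ x y z w → x * (y * z * w) ≡ x * y * z * w
      reassociate = solve-∀

  trudi-recurrence : ∀ a n → detTH a (suc n) ≡ (weights a ⊛ determinants a) n
  trudi-recurrence a n =
    trans (Δ-own-column (suc n)) (trans (Δ-closed a n) (sym (⊛-sum (weights a) (determinants a) n)))
    where open Expansion a

  trudi : ∀ a → (1s ⊖ X ⊛ weights a) ⊛ determinants a ≋ 1s
  trudi a = begin
      (1s ⊖ X ⊛ weights a) ⊛ determinants a
    ≈⟨ solve 3 (λ x w d → (con (+ 1) :- x :* w) :* d := d :- x :* (w :* d)) ≋-refl X (weights a) (determinants a) ⟩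
      determinants a ⊖ X ⊛ (weights a ⊛ determinants a)
    ≈⟨ coefficientwise (λ
         { zero    → refl
         ; (suc n) → trans (cong (λ z → detTH a (suc n) - z)
                                  (trans (coeff (X-⊛ (weights a ⊛ determinants a)) (suc n)) (sym (trudi-recurrence a n))))
                           (ℤP.+-inverseʳ (detTH a (suc n))) }) ⟩
      1s
    ∎
    where open ≋-Reasoning

  generating-function : ∀ a {F den num} → F 0 ≡ + 0 → (∀ n → F (suc n) ≡ detTH a (suc n)) →
    (den ⊕ num) ⊛ (X ⊛ weights a) ≋ num → F ≐ num / den
  generating-function a {F} {den} {num} F₀ Fₙ key = coeff (begin
      den ⊛ F
    ≈⟨ ⊛-cong ≋-refl (coefficientwise λ { zero → F₀ ; (suc n) → trans (Fₙ n) (sym (ℤP.+-identityʳ _)) }) ⟩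
      den ⊛ (D ⊖ 1s)
    ≈⟨ solve 4 (λ den num c d → den :* (d :- con (+ 1))
                 := (den :+ num) :* ((con (+ 1) :- c) :* d :- con (+ 1)) :+ d :* ((den :+ num) :* c :- num) :+ num)
             ≋-refl den num c D ⟩
      (den ⊕ num) ⊛ ((1s ⊖ c) ⊛ D ⊖ 1s) ⊕ D ⊛ ((den ⊕ num) ⊛ c ⊖ num) ⊕ num
    ≈⟨ ⊕-cong (⊕-cong (⊛-cong ≋-refl (⊖-cong (trudi a) ≋-refl)) (⊛-cong ≋-refl (⊖-cong key ≋-refl))) ≋-refl ⟩
      (den ⊕ num) ⊛ (1s ⊖ 1s) ⊕ D ⊛ (num ⊖ num) ⊕ num
    ≈⟨ solve 3 (λ s d num → s :* (con (+ 1) :- con (+ 1)) :+ d :* (num :- num) :+ num := num)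
             ≋-refl (den ⊕ num) D num ⟩
      num
    ∎)
    where
    open ≋-Reasoning
    D c : Series
    D = determinants a
    c = X ⊛ weights a

  -- a₀ = -1: all weights (-a₀)ⁱ = 1
  weights-minus : ∀ f → weights (withHead (- + 1) f) ≋ (λ i → f (suc i))
  weights-minus f = coefficientwise λ i → trans (cong (_* f (suc i)) (ℤP.^-zeroˡ i)) (ℤP.*-identityˡ (f (suc i)))

  -- a₀ = 1: the weights (-1)ⁱ substitute x ↦ -x
  weights-plus : ∀ f → weights (withHead (+ 1) f) ≋ alt (λ i → f (suc i))
  weights-plus f = coefficientwise λ i → cong (_* f (suc i)) (minus-one-power i)
    where
    minus-one-power : ∀ i → (- + 1) ^ i ≡ sign i
    minus-one-power zero    = refl
    minus-one-power (suc i) = trans (ℤP.-1*i≡-i _) (cong -_ (minus-one-power i))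

  generating-function-from : ∀ a {F den num E Q R} → F 0 ≡ + 0 → (∀ n → F (suc n) ≡ detTH a (suc n)) →
    weights a ≋ E → Q ⊛ E ≋ R → den ⊕ num ≋ Q → X ⊛ R ≋ num → F ≐ num / den
  generating-function-from a {den = den} {num} {E} {Q} {R} F₀ Fₙ W=E QE=R den+num=Q XR=num =
    generating-function a F₀ Fₙ (begin
      (den ⊕ num) ⊛ (X ⊛ weights a) ≈⟨ ⊛-cong den+num=Q (⊛-cong ≋-refl W=E) ⟩
      Q ⊛ (X ⊛ E)                   ≈⟨ solve 3 (λ q x e → q :* (x :* e) := x :* (q :* e)) ≋-refl Q X E ⟩
      X ⊛ (Q ⊛ E)                   ≈⟨ ⊛-cong ≋-refl QE=R ⟩
      X ⊛ R                         ≈⟨ XR=num ⟩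
      num                           ∎)
    where open ≋-Reasoning

module TribonacciEquations where

  open import Defs
  open PowerSeries
  open Shifts using (double; drop; X^-cancel; factor-X^; head-tail; shift; shift-at)
  open Bisection
  open import Data.Nat using (ℕ; suc; s≤s; z≤n)
  import Data.Nat.Properties as ℕP
  open import Data.Integer using (+_; _+_)
  open import Relation.Binary.PropositionalEquality using (_≡_; refl; trans; cong)

  -- odd r = 2k + 1:  ev P = 1 - x,  od P = -1 - xᵏ,  ev xᵐ = xᵏ,  od xᵐ = 0
  Q-odd R-odd : Shape
  Q-odd x p = (con (+ 1) :- x) :* (con (+ 1) :- x) :- x :* ((con (+ 1) :+ p) :* (con (+ 1) :+ p))
  R-odd x p = (con (+ 1) :- x) :* p

  odd-equation : ∀ k → Q-odd [ X , X ^ˢ k ] ⊛ ev (T (suc (double k))) ≋ R-odd [ X , X ^ˢ k ]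
  odd-equation k = begin
      Q-odd [ X , p ] ⊛ ev t
    ≈⟨ ⊛-cong (solve 2 (λ x p → Q-odd x p := e x p :* e x p :- x :* (o x p :* o x p)) ≋-refl X p) ≋-refl ⟩
      (e [ X , p ] ⊛ e [ X , p ] ⊖ X ⊛ (o [ X , p ] ⊛ o [ X , p ])) ⊛ ev t
    ≈⟨ bisection {f = P} ev-P od-P (≋-trans (ev-cong tribonacci-equation) (ev-even-power k))
                                   (≋-trans (od-cong tribonacci-equation) (od-even-power k)) ⟩
      e [ X , p ] ⊛ p ⊖ X ⊛ (o [ X , p ] ⊛ 0s)
    ≈⟨ solve 2 (λ x p → e x p :* p :- x :* (o x p :* con (+ 0)) := R-odd x p) ≋-refl X p ⟩
      R-odd [ X , p ]
    ∎
    where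
    open ≋-Reasoning
    open Tribonacci (double k)
    p : Series
    p = X ^ˢ k
    e o : Shape
    e x p = con (+ 1) :- con (+ 0) :- x :^ 1 :- con (+ 0)
    o x p = con (+ 0) :- con (+ 1) :- con (+ 0) :- p
    ev-P : ev P ≋ e [ X , p ]
    ev-P = ⊖-cong (⊖-cong (⊖-cong ev-1 ev-X) (ev-even-power 1)) (ev-odd-power k)
    od-P : od P ≋ o [ X , p ]
    od-P = ⊖-cong (⊖-cong (⊖-cong od-1 od-X) (od-even-power 1)) (od-odd-power k)

  -- even r = 2k + 2:  ev P = 1 - x - x·xᵏ,  od P = -1,  ev xᵐ = 0,  od xᵐ = xᵏ
  Q-even R-even : Shape
  Q-even x p = (con (+ 1) :- x :- x :* p) :* (con (+ 1) :- x :- x :* p) :- x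
  R-even x p = x :* p

  even-equation : ∀ k → Q-even [ X , X ^ˢ k ] ⊛ ev (T (double (suc k))) ≋ R-even [ X , X ^ˢ k ]
  even-equation k = begin
      Q-even [ X , p ] ⊛ ev t
    ≈⟨ ⊛-cong (solve 2 (λ x p → Q-even x p := e x p :* e x p :- x :* (o x p :* o x p)) ≋-refl X p) ≋-refl ⟩
      (e [ X , p ] ⊛ e [ X , p ] ⊖ X ⊛ (o [ X , p ] ⊛ o [ X , p ])) ⊛ ev t
    ≈⟨ bisection {f = P} ev-P od-P (≋-trans (ev-cong tribonacci-equation) (ev-odd-power k))
                                   (≋-trans (od-cong tribonacci-equation) (od-odd-power k)) ⟩
      e [ X , p ] ⊛ 0s ⊖ X ⊛ (o [ X , p ] ⊛ p)
    ≈⟨ solve 2 (λ x p → e x p :* con (+ 0) :- x :* (o x p :* p) := R-even x p) ≋-refl X p ⟩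
      R-even [ X , p ]
    ∎
    where
    open ≋-Reasoning
    open Tribonacci (suc (double k))
    p : Series
    p = X ^ˢ k
    e o : Shape
    e x p = con (+ 1) :- con (+ 0) :- x :^ 1 :- x :* p
    o x p = con (+ 0) :- con (+ 1) :- con (+ 0) :- con (+ 0)
    ev-P : ev P ≋ e [ X , p ]
    ev-P = ⊖-cong (⊖-cong (⊖-cong ev-1 ev-X) (ev-even-power 1)) (ev-even-power (suc k))
    od-P : od P ≋ o [ X , p ]
    od-P = ⊖-cong (⊖-cong (⊖-cong od-1 od-X) (od-even-power 1)) (od-even-power (suc k))

  -- r = s + 3: P = 1 - x - x² - x³·xˢ, and the tail w = Σ T_{r+2+i} xⁱ of T = x^{r-1}(1 + x + 2x² + x³w)
  Q-tail R-tail : Shape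
  Q-tail x q = con (+ 1) :- x :- x :^ 2 :- x :* (x :* (x :* q))
  R-tail x q = con (+ 3) :+ con (+ 2) :* x :+ q :* (con (+ 1) :+ x :+ con (+ 2) :* x :^ 2)

  tail-equation : ∀ s → let m = suc (suc s) in
    Q-tail [ X , X ^ˢ s ] ⊛ drop 3 (drop m (T (suc m))) ≋ R-tail [ X , X ^ˢ s ]
  tail-equation s = X^-cancel 3 (begin
      X ^ˢ 3 ⊛ (P ⊛ w)
    ≈⟨ solve 3 (λ x q w → x :^ 3 :* (Q-tail x q :* w)
                 := (Q-tail x q :* (con (+ 1) :+ x :* (con (+ 1) :+ x :* (con (+ 2) :+ x :* w))) :- con (+ 1))
                    :+ x :^ 3 :* R-tail x q)
             ≋-refl X (X ^ˢ s) w ⟩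
      (P ⊛ (1s ⊕ X ⊛ (1s ⊕ X ⊛ (const (+ 2) ⊕ X ⊛ w))) ⊖ 1s) ⊕ X ^ˢ 3 ⊛ R-tail [ X , X ^ˢ s ]
    ≈⟨ ⊕-cong (⊖-cong (≋-trans (⊛-cong ≋-refl (≋-sym u-expanded)) P-u) ≋-refl) ≋-refl ⟩
      (1s ⊖ 1s) ⊕ X ^ˢ 3 ⊛ R-tail [ X , X ^ˢ s ]
    ≈⟨ solve 1 (λ z → (con (+ 1) :- con (+ 1)) :+ z := z) ≋-refl (X ^ˢ 3 ⊛ R-tail [ X , X ^ˢ s ]) ⟩
      X ^ˢ 3 ⊛ R-tail [ X , X ^ˢ s ]
    ∎)
    where
    open ≋-Reasoning
    m : ℕ
    m = suc (suc s)
    open Tribonacci m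
    u w : Series
    u = drop m t
    w = drop 3 u
    -- P·t = xᵐ and t = xᵐ·u give P·u = 1
    P-u : P ⊛ u ≋ 1s
    P-u = X^-cancel m (begin
        X ^ˢ m ⊛ (P ⊛ u)  ≈⟨ solve 3 (λ y p u → y :* (p :* u) := p :* (y :* u)) ≋-refl (X ^ˢ m) P u ⟩
        P ⊛ (X ^ˢ m ⊛ u)  ≈⟨ ⊛-cong ≋-refl (≋-sym (factor-X^ m t t-below)) ⟩
        P ⊛ t             ≈⟨ tribonacci-equation ⟩
        X ^ˢ m            ≈⟨ ≋-sym (⊛-identityʳ (X ^ˢ m)) ⟩
        X ^ˢ m ⊛ 1s       ∎)
    -- the leading coefficients T_m = 1, T_{m+1} = T_m = 1, T_{m+2} = T_{m+1} + T_m = 2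
    terms : ∀ {a b c a' b' c'} → a ≡ a' → b ≡ b' → c ≡ c' → a + b + c ≡ a' + b' + c'
    terms refl refl refl = refl
    t-m+1 : t (suc m) ≡ + 1
    t-m+1 = trans (t-recurrence m (ℕP.n<1+n m))
                  (terms t-leading (shifted-vanishing 0 m ℕP.≤-refl) (shifted-vanishing (suc s) m ℕP.≤-refl))
    t-m+2 : t (suc (suc m)) ≡ + 2
    t-m+2 = trans (t-recurrence (suc m) (ℕP.m≤n⇒m≤1+n (ℕP.n<1+n m)))
                  (terms t-m+1 t-leading (trans (cong (shift m t) (ℕP.+-comm 1 m))
                                                (trans (shift-at m t 1) (t-below 1 (s≤s (s≤s z≤n))))))
    u₀ : u 0 ≡ + 1
    u₀ = trans (cong t (ℕP.+-identityʳ m)) t-leading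
    u₁ : u 1 ≡ + 1
    u₁ = trans (cong t (ℕP.+-comm m 1)) t-m+1
    u₂ : u 2 ≡ + 2
    u₂ = trans (cong t (ℕP.+-comm m 2)) t-m+2
    u-expanded : u ≋ 1s ⊕ X ⊛ (1s ⊕ X ⊛ (const (+ 2) ⊕ X ⊛ w))
    u-expanded = begin
        u
      ≈⟨ head-tail u ⟩
        const (u 0) ⊕ X ⊛ drop 1 u
      ≈⟨ ⊕-cong (const-cong u₀) (⊛-cong ≋-refl (head-tail (drop 1 u))) ⟩
        1s ⊕ X ⊛ (const (u 1) ⊕ X ⊛ drop 1 (drop 1 u))
      ≈⟨ ⊕-cong (≋-refl {1s}) (⊛-cong (≋-refl {X})
           (⊕-cong (const-cong u₁) (⊛-cong (≋-refl {X}) (head-tail (drop 1 (drop 1 u)))))) ⟩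
        1s ⊕ X ⊛ (1s ⊕ X ⊛ (const (u 2) ⊕ X ⊛ w))
      ≈⟨ ⊕-cong (≋-refl {1s}) (⊛-cong (≋-refl {X})
           (⊕-cong (≋-refl {1s}) (⊛-cong (≋-refl {X}) (⊕-cong (const-cong u₂) (≋-refl {X ⊛ w}))))) ⟩
        1s ⊕ X ⊛ (1s ⊕ X ⊛ (const (+ 2) ⊕ X ⊛ w))
      ∎

module Identities where

  open import Defs
  open PowerSeries
  open Shifts using (2*≡double; drop; ·-as-⊛; ^-+1; ^-+2; ^-double; ^-double-neg)
  open Alternation using (alt-cong; alt-X; alt-X^; alt-shape)
  open Bisection using (ev)
  open ToeplitzHessenberg using (weights-minus; weights-plus; generating-function-from)
  open TribonacciEquations
  open import Data.Nat using (ℕ; zero; suc; _+_; _*_; _∸_; _≤_; s≤s)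
  open import Data.Nat.Tactic.RingSolver using (solve-∀)
  open import Data.Integer using (ℤ; +_; -_)
  open import Relation.Binary.PropositionalEquality using (_≡_; refl; trans; cong)

  even-entries : ∀ r → (λ i → T r (2 * suc i ∸ 2)) ≋ ev (T r)
  even-entries r = coefficientwise λ i → cong (λ j → T r (j ∸ 2)) (2*≡double (suc i))

  odd-plus : ∀ r k → r ≡ suc (2 * k) →
    genEven r (+ 1) ≐ ((⊝ X) ^ˢ (k + 1)) ⊛ (const (- (+ 1)) ⊖ X)
                    / (const (+ 1) ⊕ (+ 3) · X ⊕ X ^ˢ 2 ⊖ (⊝ X) ^ˢ (k + 1)
                       ⊖ (⊝ X) ^ˢ (k + 2) ⊕ X ^ˢ r)
  odd-plus r k r≡2k+1 with trans r≡2k+1 (cong suc (2*≡double k))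
  ... | refl = generating-function-from a refl (λ _ → refl)
                 (≋-trans (weights-plus f) (alt-cong (even-entries r)))
                 (alt-shape Q-odd R-odd alt-X (alt-X^ k) (odd-equation k)) den+num x·R
    where
    open ≋-Reasoning
    f : ℕ → ℤ
    f i = T r (2 * i ∸ 2)
    a : ℕ → ℤ
    a = withHead (+ 1) f
    q : Series
    q = (⊝ X) ^ˢ k
    den+num : const (+ 1) ⊕ (+ 3) · X ⊕ X ^ˢ 2 ⊖ (⊝ X) ^ˢ (k + 1) ⊖ (⊝ X) ^ˢ (k + 2) ⊕ X ^ˢ r
              ⊕ ((⊝ X) ^ˢ (k + 1)) ⊛ (const (- (+ 1)) ⊖ X) ≋ Q-odd [ ⊝ X , q ]
    den+num = begin
        const (+ 1) ⊕ (+ 3) · X ⊕ X ^ˢ 2 ⊖ (⊝ X) ^ˢ (k + 1) ⊖ (⊝ X) ^ˢ (k + 2) ⊕ X ^ˢ r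
        ⊕ ((⊝ X) ^ˢ (k + 1)) ⊛ (const (- (+ 1)) ⊖ X)
      ≈⟨ ⊕-cong (⊕-cong (⊖-cong (⊖-cong (⊕-cong (⊕-cong (≋-refl {1s}) (·-as-⊛ (+ 3) X)) (≋-refl {X ^ˢ 2}))
                                         (^-+1 (⊝ X) k))
                                (^-+2 (⊝ X) k))
                        (⊛-cong (≋-refl {X}) (≋-trans (≋-sym (^-double-neg X k)) (^-double (⊝ X) k))))
                (⊛-cong (^-+1 (⊝ X) k) (≋-refl {const (- (+ 1)) ⊖ X})) ⟩
        1s ⊕ const (+ 3) ⊛ X ⊕ X ^ˢ 2 ⊖ ⊝ X ⊛ q ⊖ ⊝ X ⊛ (⊝ X ⊛ q) ⊕ X ⊛ (q ⊛ q)
        ⊕ (⊝ X ⊛ q) ⊛ (const (- (+ 1)) ⊖ X)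
      ≈⟨ solve 2 (λ x q → con (+ 1) :+ con (+ 3) :* x :+ x :^ 2 :- :- x :* q :- :- x :* (:- x :* q)
                          :+ x :* (q :* q) :+ (:- x :* q) :* (con (- (+ 1)) :- x) := Q-odd (:- x) q) ≋-refl X q ⟩
        Q-odd [ ⊝ X , q ]
      ∎
    x·R : X ⊛ R-odd [ ⊝ X , q ] ≋ ((⊝ X) ^ˢ (k + 1)) ⊛ (const (- (+ 1)) ⊖ X)
    x·R = ≋-trans (solve 2 (λ x q → x :* R-odd (:- x) q := (:- x :* q) :* (con (- (+ 1)) :- x)) ≋-refl X q)
                  (⊛-cong (≋-sym (^-+1 (⊝ X) k)) (≋-refl {const (- (+ 1)) ⊖ X}))

  even-plus : ∀ r → 2 ≤ r → ∀ k → r ≡ 2 * k →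
    genEven r (+ 1) ≐ ⊝ ((⊝ X) ^ˢ (k + 1))
                    / (const (+ 1) ⊕ (+ 3) · X ⊕ X ^ˢ 2 ⊖ (+ 2) · ((⊝ X) ^ˢ k)
                       ⊕ (+ 3) · ((⊝ X) ^ˢ (k + 1)) ⊕ X ^ˢ r)
  even-plus .zero () zero    refl
  even-plus r     _  (suc k) r≡2k with trans r≡2k (2*≡double (suc k))
  ... | refl = generating-function-from a refl (λ _ → refl)
                 (≋-trans (weights-plus f) (alt-cong (even-entries r)))
                 (alt-shape Q-even R-even alt-X (alt-X^ k) (even-equation k)) den+num x·R
    where
    open ≋-Reasoning
    f : ℕ → ℤ
    f i = T r (2 * i ∸ 2)
    a : ℕ → ℤ
    a = withHead (+ 1) f
    q : Series
    q = (⊝ X) ^ˢ k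
    den+num : const (+ 1) ⊕ (+ 3) · X ⊕ X ^ˢ 2 ⊖ (+ 2) · ((⊝ X) ^ˢ suc k) ⊕ (+ 3) · ((⊝ X) ^ˢ (suc k + 1)) ⊕ X ^ˢ r
              ⊕ ⊝ ((⊝ X) ^ˢ (suc k + 1)) ≋ Q-even [ ⊝ X , q ]
    den+num = begin
        const (+ 1) ⊕ (+ 3) · X ⊕ X ^ˢ 2 ⊖ (+ 2) · ((⊝ X) ^ˢ suc k) ⊕ (+ 3) · ((⊝ X) ^ˢ (suc k + 1)) ⊕ X ^ˢ r
        ⊕ ⊝ ((⊝ X) ^ˢ (suc k + 1))
      ≈⟨ ⊕-cong (⊕-cong (⊕-cong (⊖-cong (⊕-cong (⊕-cong (≋-refl {1s}) (·-as-⊛ (+ 3) X)) (≋-refl {X ^ˢ 2}))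
                                         (·-as-⊛ (+ 2) ((⊝ X) ^ˢ suc k)))
                                (≋-trans (·-as-⊛ (+ 3) ((⊝ X) ^ˢ (suc k + 1)))
                                         (⊛-cong (≋-refl {const (+ 3)}) (^-+1 (⊝ X) (suc k)))))
                        (≋-trans (≋-sym (^-double-neg X (suc k))) (^-double (⊝ X) (suc k))))
                (⊝-cong (^-+1 (⊝ X) (suc k))) ⟩
        1s ⊕ const (+ 3) ⊛ X ⊕ X ^ˢ 2 ⊖ const (+ 2) ⊛ (⊝ X ⊛ q) ⊕ const (+ 3) ⊛ (⊝ X ⊛ (⊝ X ⊛ q))
        ⊕ (⊝ X ⊛ q) ⊛ (⊝ X ⊛ q) ⊕ ⊝ (⊝ X ⊛ (⊝ X ⊛ q))
      ≈⟨ solve 2 (λ x q → con (+ 1) :+ con (+ 3) :* x :+ x :^ 2 :- con (+ 2) :* (:- x :* q)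
                          :+ con (+ 3) :* (:- x :* (:- x :* q)) :+ (:- x :* q) :* (:- x :* q)
                          :+ :- (:- x :* (:- x :* q)) := Q-even (:- x) q) ≋-refl X q ⟩
        Q-even [ ⊝ X , q ]
      ∎
    x·R : X ⊛ R-even [ ⊝ X , q ] ≋ ⊝ ((⊝ X) ^ˢ (suc k + 1))
    x·R = ≋-trans (solve 2 (λ x q → x :* R-even (:- x) q := :- (:- x :* (:- x :* q))) ≋-refl X q)
                  (⊝-cong (≋-sym (^-+1 (⊝ X) (suc k))))

  odd-minus : ∀ r k → r ≡ suc (2 * k) →
    genEven r (- (+ 1)) ≐ (X ^ˢ (k + 1)) ⊛ (const (+ 1) ⊖ X)
                        / (const (+ 1) ⊖ (+ 3) · X ⊕ X ^ˢ 2 ⊖ (+ 3) · (X ^ˢ (k + 1))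
                           ⊕ X ^ˢ (k + 2) ⊖ X ^ˢ r)
  odd-minus r k r≡2k+1 with trans r≡2k+1 (cong suc (2*≡double k))
  ... | refl = generating-function-from a refl (λ _ → refl)
                 (≋-trans (weights-minus f) (even-entries r)) (odd-equation k) den+num x·R
    where
    open ≋-Reasoning
    f : ℕ → ℤ
    f i = T r (2 * i ∸ 2)
    a : ℕ → ℤ
    a = withHead (- (+ 1)) f
    p : Series
    p = X ^ˢ k
    den+num : const (+ 1) ⊖ (+ 3) · X ⊕ X ^ˢ 2 ⊖ (+ 3) · (X ^ˢ (k + 1)) ⊕ X ^ˢ (k + 2) ⊖ X ^ˢ r
              ⊕ (X ^ˢ (k + 1)) ⊛ (const (+ 1) ⊖ X) ≋ Q-odd [ X , p ]
    den+num = begin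
        const (+ 1) ⊖ (+ 3) · X ⊕ X ^ˢ 2 ⊖ (+ 3) · (X ^ˢ (k + 1)) ⊕ X ^ˢ (k + 2) ⊖ X ^ˢ r
        ⊕ (X ^ˢ (k + 1)) ⊛ (const (+ 1) ⊖ X)
      ≈⟨ ⊕-cong (⊖-cong (⊕-cong (⊖-cong (⊕-cong (⊖-cong (≋-refl {1s}) (·-as-⊛ (+ 3) X)) (≋-refl {X ^ˢ 2}))
                                         (≋-trans (·-as-⊛ (+ 3) (X ^ˢ (k + 1))) (⊛-cong (≋-refl {const (+ 3)}) (^-+1 X k))))
                                (^-+2 X k))
                        (⊛-cong (≋-refl {X}) (^-double X k)))
                (⊛-cong (^-+1 X k) (≋-refl {1s ⊖ X})) ⟩
        1s ⊖ const (+ 3) ⊛ X ⊕ X ^ˢ 2 ⊖ const (+ 3) ⊛ (X ⊛ p) ⊕ X ⊛ (X ⊛ p) ⊖ X ⊛ (p ⊛ p)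
        ⊕ (X ⊛ p) ⊛ (1s ⊖ X)
      ≈⟨ solve 2 (λ x p → con (+ 1) :- con (+ 3) :* x :+ x :^ 2 :- con (+ 3) :* (x :* p) :+ x :* (x :* p)
                          :- x :* (p :* p) :+ (x :* p) :* (con (+ 1) :- x) := Q-odd x p) ≋-refl X p ⟩
        Q-odd [ X , p ]
      ∎
    x·R : X ⊛ R-odd [ X , p ] ≋ (X ^ˢ (k + 1)) ⊛ (const (+ 1) ⊖ X)
    x·R = ≋-trans (solve 2 (λ x p → x :* R-odd x p := (x :* p) :* (con (+ 1) :- x)) ≋-refl X p)
                  (⊛-cong (≋-sym (^-+1 X k)) (≋-refl {1s ⊖ X}))

  even-minus : ∀ r → 2 ≤ r → ∀ k → r ≡ 2 * k →
    genEven r (- (+ 1)) ≐ X ^ˢ (k + 1)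
                        / (const (+ 1) ⊖ (+ 3) · X ⊕ X ^ˢ 2 ⊖ (+ 2) · (X ^ˢ k)
                           ⊕ X ^ˢ (k + 1) ⊕ X ^ˢ r)
  even-minus .zero () zero    refl
  even-minus r     _  (suc k) r≡2k with trans r≡2k (2*≡double (suc k))
  ... | refl = generating-function-from a refl (λ _ → refl)
                 (≋-trans (weights-minus f) (even-entries r)) (even-equation k) den+num x·R
    where
    open ≋-Reasoning
    f : ℕ → ℤ
    f i = T r (2 * i ∸ 2)
    a : ℕ → ℤ
    a = withHead (- (+ 1)) f
    p : Series
    p = X ^ˢ k
    den+num : const (+ 1) ⊖ (+ 3) · X ⊕ X ^ˢ 2 ⊖ (+ 2) · (X ^ˢ suc k) ⊕ X ^ˢ (suc k + 1) ⊕ X ^ˢ r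
              ⊕ X ^ˢ (suc k + 1) ≋ Q-even [ X , p ]
    den+num = begin
        const (+ 1) ⊖ (+ 3) · X ⊕ X ^ˢ 2 ⊖ (+ 2) · (X ^ˢ suc k) ⊕ X ^ˢ (suc k + 1) ⊕ X ^ˢ r
        ⊕ X ^ˢ (suc k + 1)
      ≈⟨ ⊕-cong (⊕-cong (⊕-cong (⊖-cong (⊕-cong (⊖-cong (≋-refl {1s}) (·-as-⊛ (+ 3) X)) (≋-refl {X ^ˢ 2}))
                                         (·-as-⊛ (+ 2) (X ^ˢ suc k)))
                                (^-+1 X (suc k)))
                        (^-double X (suc k)))
                (^-+1 X (suc k)) ⟩
        1s ⊖ const (+ 3) ⊛ X ⊕ X ^ˢ 2 ⊖ const (+ 2) ⊛ (X ⊛ p) ⊕ X ⊛ (X ⊛ p) ⊕ (X ⊛ p) ⊛ (X ⊛ p)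
        ⊕ X ⊛ (X ⊛ p)
      ≈⟨ solve 2 (λ x p → con (+ 1) :- con (+ 3) :* x :+ x :^ 2 :- con (+ 2) :* (x :* p) :+ x :* (x :* p)
                          :+ (x :* p) :* (x :* p) :+ x :* (x :* p) := Q-even x p) ≋-refl X p ⟩
        Q-even [ X , p ]
      ∎
    x·R : X ⊛ R-even [ X , p ] ≋ X ^ˢ (suc k + 1)
    x·R = ≋-sym (^-+1 X (suc k))

  shift-plus : ∀ r → 3 ≤ r →
    genShift r ≐ (+ 3) · X ⊖ (+ 2) · (X ^ˢ 2) ⊖ (⊝ X) ^ˢ (r ∸ 2) ⊖ (⊝ X) ^ˢ (r ∸ 1)
                 ⊖ (+ 2) · ((⊝ X) ^ˢ r)
               / (const (+ 1) ⊖ (+ 2) · X ⊕ X ^ˢ 2 ⊕ (⊝ X) ^ˢ (r ∸ 2) ⊕ (⊝ X) ^ˢ (r ∸ 1)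
                  ⊕ (⊝ X) ^ˢ r)
  shift-plus r (s≤s (s≤s (s≤s {n = s} _))) = generating-function-from a refl (λ _ → refl)
    (≋-trans (weights-plus f) (alt-cong tail-entries))
    (alt-shape Q-tail R-tail alt-X (alt-X^ s) (tail-equation s)) den+num x·R
    where
    open ≋-Reasoning
    f : ℕ → ℤ
    f i = T r (i + r + 1)
    a : ℕ → ℤ
    a = withHead (+ 1) f
    q : Series
    q = (⊝ X) ^ˢ s
    tail-entries : (λ i → f (suc i)) ≋ drop 3 (drop (suc (suc s)) (T r))
    tail-entries = coefficientwise λ i → cong (T r) (index i s)
      where
      index : ∀ i s → suc i + suc (suc (suc s)) + 1 ≡ suc (suc s) + (3 + i)
      index = solve-∀
    den+num : const (+ 1) ⊖ (+ 2) · X ⊕ X ^ˢ 2 ⊕ (⊝ X) ^ˢ (r ∸ 2) ⊕ (⊝ X) ^ˢ (r ∸ 1) ⊕ (⊝ X) ^ˢ r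
              ⊕ ((+ 3) · X ⊖ (+ 2) · (X ^ˢ 2) ⊖ (⊝ X) ^ˢ (r ∸ 2) ⊖ (⊝ X) ^ˢ (r ∸ 1) ⊖ (+ 2) · ((⊝ X) ^ˢ r))
              ≋ Q-tail [ ⊝ X , q ]
    den+num = begin
        const (+ 1) ⊖ (+ 2) · X ⊕ X ^ˢ 2 ⊕ (⊝ X) ^ˢ (r ∸ 2) ⊕ (⊝ X) ^ˢ (r ∸ 1) ⊕ (⊝ X) ^ˢ r
        ⊕ ((+ 3) · X ⊖ (+ 2) · (X ^ˢ 2) ⊖ (⊝ X) ^ˢ (r ∸ 2) ⊖ (⊝ X) ^ˢ (r ∸ 1) ⊖ (+ 2) · ((⊝ X) ^ˢ r))
      ≈⟨ ⊕-cong (⊕-cong (⊕-cong (⊕-cong (⊕-cong (⊖-cong (≋-refl {1s}) (·-as-⊛ (+ 2) X)) (≋-refl {X ^ˢ 2}))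
                                         (≋-refl {⊝ X ⊛ q}))
                                (≋-refl {⊝ X ⊛ (⊝ X ⊛ q)}))
                        (≋-refl {⊝ X ⊛ (⊝ X ⊛ (⊝ X ⊛ q))}))
                (⊖-cong (⊖-cong (⊖-cong (⊖-cong (·-as-⊛ (+ 3) X) (·-as-⊛ (+ 2) (X ^ˢ 2)))
                                         (≋-refl {⊝ X ⊛ q}))
                                (≋-refl {⊝ X ⊛ (⊝ X ⊛ q)}))
                        (·-as-⊛ (+ 2) ((⊝ X) ^ˢ r))) ⟩
        1s ⊖ const (+ 2) ⊛ X ⊕ X ^ˢ 2 ⊕ ⊝ X ⊛ q ⊕ ⊝ X ⊛ (⊝ X ⊛ q) ⊕ ⊝ X ⊛ (⊝ X ⊛ (⊝ X ⊛ q))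
        ⊕ (const (+ 3) ⊛ X ⊖ const (+ 2) ⊛ X ^ˢ 2 ⊖ ⊝ X ⊛ q ⊖ ⊝ X ⊛ (⊝ X ⊛ q)
           ⊖ const (+ 2) ⊛ (⊝ X ⊛ (⊝ X ⊛ (⊝ X ⊛ q))))
      ≈⟨ solve 2 (λ x q → con (+ 1) :- con (+ 2) :* x :+ x :^ 2 :+ :- x :* q :+ :- x :* (:- x :* q)
                          :+ :- x :* (:- x :* (:- x :* q))
                          :+ (con (+ 3) :* x :- con (+ 2) :* x :^ 2 :- :- x :* q :- :- x :* (:- x :* q)
                              :- con (+ 2) :* (:- x :* (:- x :* (:- x :* q))))
                          := Q-tail (:- x) q) ≋-refl X q ⟩
        Q-tail [ ⊝ X , q ]
      ∎
    x·R : X ⊛ R-tail [ ⊝ X , q ]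
          ≋ (+ 3) · X ⊖ (+ 2) · (X ^ˢ 2) ⊖ (⊝ X) ^ˢ (r ∸ 2) ⊖ (⊝ X) ^ˢ (r ∸ 1) ⊖ (+ 2) · ((⊝ X) ^ˢ r)
    x·R = begin
        X ⊛ R-tail [ ⊝ X , q ]
      ≈⟨ solve 2 (λ x q → x :* R-tail (:- x) q
                          := con (+ 3) :* x :- con (+ 2) :* x :^ 2 :- :- x :* q :- :- x :* (:- x :* q)
                             :- con (+ 2) :* (:- x :* (:- x :* (:- x :* q)))) ≋-refl X q ⟩
        const (+ 3) ⊛ X ⊖ const (+ 2) ⊛ X ^ˢ 2 ⊖ ⊝ X ⊛ q ⊖ ⊝ X ⊛ (⊝ X ⊛ q)
        ⊖ const (+ 2) ⊛ (⊝ X ⊛ (⊝ X ⊛ (⊝ X ⊛ q)))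
      ≈⟨ ≋-sym (⊖-cong (⊖-cong (⊖-cong (⊖-cong (·-as-⊛ (+ 3) X) (·-as-⊛ (+ 2) (X ^ˢ 2)))
                                        (≋-refl {⊝ X ⊛ q}))
                               (≋-refl {⊝ X ⊛ (⊝ X ⊛ q)}))
                       (·-as-⊛ (+ 2) ((⊝ X) ^ˢ r))) ⟩
        (+ 3) · X ⊖ (+ 2) · (X ^ˢ 2) ⊖ (⊝ X) ^ˢ (r ∸ 2) ⊖ (⊝ X) ^ˢ (r ∸ 1) ⊖ (+ 2) · ((⊝ X) ^ˢ r)
      ∎


open import Defs
open import Data.Nat using (suc; _≤_; _+_; _*_; _∸_)
import Data.Nat.Properties as ℕP
open import Data.Integer using (+_; -_)
open import Data.Product using (_×_; _,_)
open import Relation.Binary.PropositionalEquality using (_≡_)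
open Identities

theorem10 : ∀ (r : ℕ) → 3 ≤ r →
    -- first identity: det(1; T_0, T_2, …, T_{2n-2})
    ((∀ k → r ≡ suc (2 * k) →
        genEven r (+ 1) ≐ ((⊝ X) ^ˢ (k + 1)) ⊛ (const (- (+ 1)) ⊖ X)
                        / (const (+ 1) ⊕ (+ 3) · X ⊕ X ^ˢ 2 ⊖ (⊝ X) ^ˢ (k + 1)
                           ⊖ (⊝ X) ^ˢ (k + 2) ⊕ X ^ˢ r))
     × (∀ k → r ≡ 2 * k →
        genEven r (+ 1) ≐ ⊝ ((⊝ X) ^ˢ (k + 1))
                        / (const (+ 1) ⊕ (+ 3) · X ⊕ X ^ˢ 2 ⊖ (+ 2) · ((⊝ X) ^ˢ k)
                           ⊕ (+ 3) · ((⊝ X) ^ˢ (k + 1)) ⊕ X ^ˢ r)))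
    ×
    -- second identity: det(-1; T_0, T_2, …, T_{2n-2})
    ((∀ k → r ≡ suc (2 * k) →
        genEven r (- (+ 1)) ≐ (X ^ˢ (k + 1)) ⊛ (const (+ 1) ⊖ X)
                            / (const (+ 1) ⊖ (+ 3) · X ⊕ X ^ˢ 2 ⊖ (+ 3) · (X ^ˢ (k + 1))
                               ⊕ X ^ˢ (k + 2) ⊖ X ^ˢ r))
     × (∀ k → r ≡ 2 * k →
        genEven r (- (+ 1)) ≐ X ^ˢ (k + 1)
                            / (const (+ 1) ⊖ (+ 3) · X ⊕ X ^ˢ 2 ⊖ (+ 2) · (X ^ˢ k)
                               ⊕ X ^ˢ (k + 1) ⊕ X ^ˢ r)))
    ×
    -- third identity: det(1; T_{r+2}, T_{r+3}, …, T_{n+r+1})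
    (genShift r ≐ (+ 3) · X ⊖ (+ 2) · (X ^ˢ 2) ⊖ (⊝ X) ^ˢ (r ∸ 2) ⊖ (⊝ X) ^ˢ (r ∸ 1)
                  ⊖ (+ 2) · ((⊝ X) ^ˢ r)
                / (const (+ 1) ⊖ (+ 2) · X ⊕ X ^ˢ 2 ⊕ (⊝ X) ^ˢ (r ∸ 2) ⊕ (⊝ X) ^ˢ (r ∸ 1)
                   ⊕ (⊝ X) ^ˢ r))
theorem10 r r≥3 =
  (odd-plus r , even-plus r r≥2) , (odd-minus r , even-minus r r≥2) , shift-plus r r≥3
  where
  r≥2 : 2 ≤ r
  r≥2 = ℕP.<⇒≤ r≥3
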